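{- Let $(G_n)$ be a sequence of graphs, $G_n$ on $n$ vertices with $\alpha(G_n)\le 2$ and $t_4(G_n)=\left(\frac{3}{25}+o(1)\right)\binom n4$. Suppose that for each $n$ the vertex set is partitioned as $V(G_n)=V_1\cup V_2\cup V_3\cup V_4\cup V_5\cup U$ (indices of the $V_i$ taken modulo $5$) such that, for some function $h(n)=o(n)$: (1) for every $i$ and every $v\in V_i$, $v$ is adjacent to all but at most $h(n)$ vertices of $V_{i-1}\cup V_i\cup V_{i+1}$, and $v$ has at most $h(n)$ neighbours in $V_{i+2}\cup V_{i+3}$; (2) $V_2\cup V_3$, $V_3\cup V_4$ and $V_4\cup V_5$ are cliques; (3) $|V_1|=\frac n5+o(n)$, $|V_2\cup V_3|,|V_3\cup V_4|,|V_4\cup V_5|=\frac{2n}{5}+o(n)$, and $|U|=o(n)$. Then for all sufficiently large $n$, $V_i\cup V_{i+1}$ is a clique for every $1\le i\le 5$, and $|V_i|=\frac n5+o(n)$ for every $i$.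
   Context: $\alpha(G)$ denotes the independence number of $G$ and $t_4(G)$ the number of $4$-cliques of $G$. -}

module Defs where

open import Data.Nat using (ℕ; zero; suc; _+_; _*_; _≤_; _≥_; ∣_-_∣; _<ᵇ_)
open import Data.Nat.DivMod using (_mod_)
open import Data.Nat.Combinatorics using (_C_)
open import Data.Fin using (Fin; toℕ) renaming (_≟_ to _≟ᶠ_)
open import Data.List using (List; []; _∷_; length; filter; concatMap; map)
open import Data.List.Base using (allFin)
open import Data.Bool using (Bool; true; false; _∧_; _∨_; not; T)
open import Data.Maybe using (Maybe; just; nothing)
open import Data.Product using (Σ; ∃; _×_; _,_)
open import Data.Sum using (_⊎_)
open import Relation.Nullary using (¬_)
open import Relation.Nullary.Decidable using (⌊_⌋; T?)
open import Relation.Binary.PropositionalEquality using (_≡_; _≢_)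

record Graph (n : ℕ) : Set where
  field
    adj    : Fin n → Fin n → Bool
    sym    : ∀ u v → adj u v ≡ adj v u
    irrefl : ∀ v → adj v v ≡ false
open Graph public

count : {A : Set} → (A → Bool) → List A → ℕ
count p xs = length (filter (λ x → T? (p x)) xs)

countV : (n : ℕ) → (Fin n → Bool) → ℕ
countV n p = count p (allFin n)

_=ᶠ_ : {n : ℕ} → Fin n → Fin n → Bool
a =ᶠ b = ⌊ a ≟ᶠ b ⌋

IndepAtMost2 : {n : ℕ} → Graph n → Set
IndepAtMost2 {n} G = ∀ (a b c : Fin n) → a ≢ b → b ≢ c → a ≢ c →
  T (adj G a b ∨ adj G b c ∨ adj G a c)

t4 : {n : ℕ} → Graph n → ℕ
t4 {n} G = count isK4 quads
  where
  V = allFin n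
  quads : List (Fin n × Fin n × Fin n × Fin n)
  quads = concatMap (λ a → concatMap (λ b → concatMap (λ c →
            map (λ d → (a , b , c , d)) V) V) V) V
  lt : Fin n → Fin n → Bool
  lt x y = toℕ x <ᵇ toℕ y
  isK4 : Fin n × Fin n × Fin n × Fin n → Bool
  isK4 (a , b , c , d) = lt a b ∧ lt b c ∧ lt c d ∧
    adj G a b ∧ adj G a c ∧ adj G a d ∧ adj G b c ∧ adj G b d ∧ adj G c d

-- f(n) = (a/b) n + o(n), with b > 0:
--   for every k, eventually |b f(n) - a n| (k+1) ≤ b n
ApproxLinear : ℕ → ℕ → (ℕ → ℕ) → Set
ApproxLinear a b f = ∀ (k : ℕ) → ∃ λ N → ∀ n → n ≥ N →
  ∣ b * f n - a * n ∣ * suc k ≤ b * n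

LittleO : (ℕ → ℕ) → Set
LittleO h = ApproxLinear 0 1 h

-- t_4(G_n) = (3/25 + o(1)) C(n,4):
--   for every k, eventually |25 t4 - 3 C(n,4)| (k+1) ≤ 25 C(n,4)
T4Asymp : ((n : ℕ) → Graph n) → Set
T4Asymp G = ∀ (k : ℕ) → ∃ λ N → ∀ n → n ≥ N →
  ∣ 25 * t4 (G n) - 3 * (n C 4) ∣ * suc k ≤ 25 * (n C 4)

-- cyclic index shift in Fin 5 (indices modulo 5); V_1..V_5 are 0..4
_⊕_ : Fin 5 → ℕ → Fin 5
i ⊕ k = (toℕ i + k) mod 5

-- a partition: each vertex lies in exactly one of V_1..V_5 (just i) or U (nothing)
Partition : ℕ → Set
Partition n = Fin n → Maybe (Fin 5)

inPart : Maybe (Fin 5) → Fin 5 → Bool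
inPart nothing  i = false
inPart (just j) i = j =ᶠ i

inU : Maybe (Fin 5) → Bool
inU nothing  = true
inU (just _) = false

partSize : {n : ℕ} → Partition n → Fin 5 → ℕ
partSize {n} P i = countV n (λ v → inPart (P v) i)

uSize : {n : ℕ} → Partition n → ℕ
uSize {n} P = countV n (λ v → inU (P v))

UnionClique : {n : ℕ} → Graph n → Partition n → Fin 5 → Fin 5 → Set
UnionClique {n} G P i j = ∀ (u w : Fin n) → u ≢ w →
  T (inPart (P u) i ∨ inPart (P u) j) → T (inPart (P w) i ∨ inPart (P w) j) →
  T (adj G u w)

Cond1 : {n : ℕ} → Graph n → Partition n → ℕ → Set
Cond1 {n} G P h = ∀ (v : Fin n) (i : Fin 5) → P v ≡ just i →
    countV n (λ w → not (w =ᶠ v) ∧ in3 i (P w) ∧ not (adj G v w)) ≤ h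
  × countV n (λ w → (inPart (P w) (i ⊕ 2) ∨ inPart (P w) (i ⊕ 3)) ∧ adj G v w) ≤ h
  where
  in3 : Fin 5 → Maybe (Fin 5) → Bool
  in3 i p = inPart p (i ⊕ 4) ∨ inPart p i ∨ inPart p (i ⊕ 1)

module Submission where

-- Every 4-set inside some union V_i ∪ V_{i+1} spans a 4-clique unless it contains one of the
-- at most n·h(n) non-edges between vertices of nearby classes allowed by condition (1), and a
-- 4-set lies in two such unions only when it lies in a single class. Hence
--   t₄ ≥ Σᵢ C(|V_i| + |V_{i+1}|, 4) − Σᵢ C(|V_i|, 4) − 6 n³ h(n).
-- Given the sizes of V_1 and of the three prescribed unions, only D = 5|V_3| − n is free, and
-- the right-hand side is (75 n⁴ + 6 n² D² + 2 D² (9 n² − D²)) / (24 · 5⁴) − o(n⁴). Comparing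
-- with t₄ = (3/25 + o(1)) C(n,4) forces D = o(n), so every class has n/5 + o(n) vertices.
-- Finally, two non-adjacent vertices of V_i ∪ V_{i+1} each have at most h(n) neighbours in
-- V_{i+3}, so a vertex of V_{i+3} adjacent to neither would give an independent set of size 3.

module Counting where

  open import Defs using (count)
  open import Data.Nat
  open import Data.Nat.Properties
  open import Data.Bool using (Bool; true; false; _∧_; _∨_; not; T)
  open import Data.Bool.Properties using (T?)
  open import Data.Unit using (tt)
  open import Data.Empty using (⊥; ⊥-elim)
  open import Data.Product using (Σ; _×_; _,_)
  open import Data.List using (List; []; _∷_; length; filter; concatMap; map; _++_)
  open import Data.List.Properties using (length-++; filter-++; length-filter)
  open import Data.Nat.ListAction using (sum)
  open import Data.List.Relation.Unary.All as All using (All; []; _∷_)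
  open import Data.List.Relation.Unary.All.Properties using (¬Any⇒All¬)
  open import Data.List.Relation.Unary.Any using (any?; satisfied)
  open import Relation.Nullary using (yes; no)
  open import Relation.Binary.PropositionalEquality
  open import Function using (_∘_)
  open import Algebra.Properties.CommutativeSemigroup +-commutativeSemigroup using (interchange)

  ind : Bool → ℕ
  ind true  = 1
  ind false = 0

  ind-mono : ∀ {a b} → (T a → T b) → ind a ≤ ind b
  ind-mono {false} _ = z≤n
  ind-mono {true} {true} _ = ≤-refl
  ind-mono {true} {false} f = ⊥-elim (f tt)

  ind-∨-≤ : ∀ {a b c} → (T a → T (b ∨ c)) → ind a ≤ ind b + ind c
  ind-∨-≤ {false} _ = z≤n
  ind-∨-≤ {true} {true} _ = s≤s z≤n
  ind-∨-≤ {true} {false} {true} _ = s≤s z≤n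
  ind-∨-≤ {true} {false} {false} f = ⊥-elim (f tt)

  module _ {A : Set} where

    count-cons : (p : A → Bool) (x : A) (xs : List A) → count p (x ∷ xs) ≡ ind (p x) + count p xs
    count-cons p x xs with p x
    ... | true  = refl
    ... | false = refl

    count-++ : (p : A → Bool) (xs ys : List A) → count p (xs ++ ys) ≡ count p xs + count p ys
    count-++ p xs ys = trans (cong length (filter-++ (T? ∘ p) xs ys)) (length-++ (filter (T? ∘ p) xs))

    count≤length : (p : A → Bool) (xs : List A) → count p xs ≤ length xs
    count≤length p = length-filter (T? ∘ p)

    count-cong-All : {p q : A → Bool} (xs : List A) → All (λ x → p x ≡ q x) xs → count p xs ≡ count q xs
    count-cong-All [] [] = refl
    count-cong-All {p} {q} (x ∷ xs) (e ∷ es) = begin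
      count p (x ∷ xs)        ≡⟨ count-cons p x xs ⟩
      ind (p x) + count p xs  ≡⟨ cong₂ _+_ (cong ind e) (count-cong-All xs es) ⟩
      ind (q x) + count q xs  ≡⟨ count-cons q x xs ⟨
      count q (x ∷ xs)        ∎
      where open ≡-Reasoning

    count-cong : {p q : A → Bool} → (∀ x → p x ≡ q x) → (xs : List A) → count p xs ≡ count q xs
    count-cong e xs = count-cong-All xs (All.universal e xs)

    count-const-∧ : (b : Bool) (q : A → Bool) (xs : List A) → count (λ x → b ∧ q x) xs ≡ ind b * count q xs
    count-const-∧ true  q xs = sym (+-identityʳ _)
    count-const-∧ false q []       = refl
    count-const-∧ false q (x ∷ xs) = count-const-∧ false q xs

    count-const : (b : Bool) (xs : List A) → count (λ _ → b) xs ≤ ind b * length xs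
    count-const true  xs = ≤-trans (count≤length _ xs) (≤-reflexive (sym (+-identityʳ _)))
    count-const false xs = ≤-reflexive (count-const-∧ false (λ _ → true) xs)

    count-mono : {p q : A → Bool} → (∀ x → T (p x) → T (q x)) → (xs : List A) → count p xs ≤ count q xs
    count-mono f [] = z≤n
    count-mono {p} {q} f (x ∷ xs) rewrite count-cons p x xs | count-cons q x xs =
      +-mono-≤ (ind-mono (f x)) (count-mono f xs)

    count-∨-≤-All : {p q r : A → Bool} (xs : List A) → All (λ x → T (p x) → T (q x ∨ r x)) xs →
      count p xs ≤ count q xs + count r xs
    count-∨-≤-All [] [] = z≤n
    count-∨-≤-All {p} {q} {r} (x ∷ xs) (f ∷ fs)
      rewrite count-cons p x xs | count-cons q x xs | count-cons r x xs =
      ≤-trans (+-mono-≤ (ind-∨-≤ {b = q x} f) (count-∨-≤-All {p = p} {q} {r} xs fs))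
        (≤-reflexive (interchange (ind (q x)) (ind (r x)) _ _))

    count-∨-≤ : {p q r : A → Bool} → (∀ x → T (p x) → T (q x ∨ r x)) → (xs : List A) →
      count p xs ≤ count q xs + count r xs
    count-∨-≤ f xs = count-∨-≤-All xs (All.universal f xs)

    count-split : {p q r : A → Bool} → (∀ x → ind (p x) ≡ ind (q x) + ind (r x)) → (xs : List A) →
      count p xs ≡ count q xs + count r xs
    count-split e [] = refl
    count-split {p} {q} {r} e (x ∷ xs) rewrite count-cons p x xs | count-cons q x xs | count-cons r x xs =
      trans (cong₂ _+_ (e x) (count-split e xs)) (interchange (ind (q x)) (ind (r x)) _ _)

    count-pigeonhole : (p q r : A → Bool) (xs : List A) → count q xs + count r xs < count p xs →
      Σ A λ x → T (p x) × T (not (q x ∨ r x))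
    count-pigeonhole p q r xs lt with any? (λ x → T? (p x ∧ not (q x ∨ r x))) xs
    ... | yes some = let x , px = satisfied some in x , split (p x) px
      where
      split : ∀ a {b} → T (a ∧ not b) → T a × T (not b)
      split true t = tt , t
    ... | no none = ⊥-elim (<⇒≱ lt (count-∨-≤-All xs (All.map noCounterexample (¬Any⇒All¬ xs none))))
      where
      noCounterexample : ∀ {a b} → (T (a ∧ not b) → ⊥) → T a → T b
      noCounterexample {true} {true} _ _ = tt
      noCounterexample {true} {false} f _ = f tt

  module _ {A B : Set} where

    count-map : (p : B → Bool) (g : A → B) (xs : List A) → count p (map g xs) ≡ count (p ∘ g) xs
    count-map p g [] = refl
    count-map p g (x ∷ xs) = trans (count-cons p (g x) (map g xs))
      (trans (cong (ind (p (g x)) +_) (count-map p g xs)) (sym (count-cons (p ∘ g) x xs)))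

    count-concatMap : (p : B → Bool) (f : A → List B) (xs : List A) →
      count p (concatMap f xs) ≡ sum (map (λ x → count p (f x)) xs)
    count-concatMap p f [] = refl
    count-concatMap p f (x ∷ xs) =
      trans (count-++ p (f x) (concatMap f xs)) (cong (count p (f x) +_) (count-concatMap p f xs))

    count-concatMap-≤ : (p : B → Bool) (f : A → List B) (K : ℕ) →
      (∀ x → count p (f x) ≤ K) → (xs : List A) → count p (concatMap f xs) ≤ length xs * K
    count-concatMap-≤ p f K h [] = z≤n
    count-concatMap-≤ p f K h (x ∷ xs) rewrite count-++ p (f x) (concatMap f xs) =
      +-mono-≤ (h x) (count-concatMap-≤ p f K h xs)

    count-concatMap-≤-count : (p : B → Bool) (f : A → List B) (q : A → Bool) (K : ℕ) →
      (∀ x → count p (f x) ≤ ind (q x) * K) → (xs : List A) →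
      count p (concatMap f xs) ≤ count q xs * K
    count-concatMap-≤-count p f q K h [] = z≤n
    count-concatMap-≤-count p f q K h (x ∷ xs)
      rewrite count-++ p (f x) (concatMap f xs) | count-cons q x xs | *-distribʳ-+ K (ind (q x)) (count q xs) =
      +-mono-≤ (h x) (count-concatMap-≤-count p f q K h xs)

  module _ {A : Set} where

    sum-cong-All : {f g : A → ℕ} (xs : List A) → All (λ x → f x ≡ g x) xs → sum (map f xs) ≡ sum (map g xs)
    sum-cong-All [] [] = refl
    sum-cong-All (x ∷ xs) (e ∷ es) = cong₂ _+_ e (sum-cong-All xs es)

    sum-cong : {f g : A → ℕ} → (∀ x → f x ≡ g x) → (xs : List A) → sum (map f xs) ≡ sum (map g xs)
    sum-cong e xs = sum-cong-All xs (All.universal e xs)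

    sum-*ˡ : (k : ℕ) (f : A → ℕ) (xs : List A) → sum (map (λ x → k * f x) xs) ≡ k * sum (map f xs)
    sum-*ˡ k f [] = sym (*-zeroʳ k)
    sum-*ˡ k f (x ∷ xs) = trans (cong (k * f x +_) (sum-*ˡ k f xs)) (sym (*-distribˡ-+ k (f x) _))

    sum-map-+ : (f g : A → ℕ) (xs : List A) → sum (map (λ x → f x + g x) xs) ≡ sum (map f xs) + sum (map g xs)
    sum-map-+ f g [] = refl
    sum-map-+ f g (x ∷ xs) = trans (cong (f x + g x +_) (sum-map-+ f g xs)) (interchange (f x) (g x) _ _)

    sum-map-mono : {f g : A → ℕ} → (∀ x → f x ≤ g x) → (xs : List A) → sum (map f xs) ≤ sum (map g xs)
    sum-map-mono f≤g [] = z≤n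
    sum-map-mono f≤g (x ∷ xs) = +-mono-≤ (f≤g x) (sum-map-mono f≤g xs)

    countSum : List (A → Bool) → List A → ℕ
    countSum ps xs = sum (map (λ p → count p xs) ps)

    indSum : List (A → Bool) → A → ℕ
    indSum ps x = sum (map (λ p → ind (p x)) ps)

    countSum-cons : (ps : List (A → Bool)) (x : A) (xs : List A) →
      countSum ps (x ∷ xs) ≡ indSum ps x + countSum ps xs
    countSum-cons [] x xs = refl
    countSum-cons (p ∷ ps) x xs rewrite count-cons p x xs | countSum-cons ps x xs =
      interchange (ind (p x)) (count p xs) (indSum ps x) (countSum ps xs)

    countSum-cong : (ps qs : List (A → Bool)) → (∀ x → indSum ps x ≡ indSum qs x) →
      (xs : List A) → countSum ps xs ≡ countSum qs xs
    countSum-cong ps qs e [] = trans (countSum-[] ps) (sym (countSum-[] qs))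
      where
      countSum-[] : (rs : List (A → Bool)) → countSum rs [] ≡ 0
      countSum-[] [] = refl
      countSum-[] (r ∷ rs) = countSum-[] rs
    countSum-cong ps qs e (x ∷ xs) rewrite countSum-cons ps x xs | countSum-cons qs x xs =
      cong₂ _+_ (e x) (countSum-cong ps qs e xs)

module Quadruples where

  open import Defs using (count; countV)
  open Counting
  open import Data.Nat
  open import Data.Nat.Properties
  open import Data.Nat.Combinatorics using (_C_; nCk+nC[k+1]≡[n+1]C[k+1]; nC1≡n)
  open import Data.Bool using (Bool; true; false; _∧_; _∨_; T)
  open import Data.Bool.Properties using (∧-commutativeMonoid; T-≡)
  open import Function using (_∘_; Equivalence)
  open import Data.Unit using (tt)
  open import Data.Empty using (⊥-elim)
  open import Data.Product using (_×_; _,_)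
  open import Data.Fin using (Fin; toℕ)
  open import Data.List using (List; []; _∷_; length; map; concatMap)
  open import Data.List.Properties using (length-tabulate)
  import Data.Nat.Tactic.RingSolver as ℕ-Solver
  open import Data.List.Base using (allFin)
  open import Data.Nat.ListAction using (sum)
  open import Data.List.Relation.Unary.All as All using (All; []; _∷_)
  open import Data.List.Relation.Unary.AllPairs using (AllPairs; []; _∷_)
  open import Data.List.Relation.Unary.AllPairs.Properties using (tabulate⁺-<)
  open import Relation.Binary.PropositionalEquality
  open import Algebra.Solver.CommutativeMonoid ∧-commutativeMonoid using (solve; _⊕_; _⊜_)

  module _ {n : ℕ} where

    -- The order in which t4 lists each 4-set.
    _<ᶠ_ : Fin n → Fin n → Bool
    x <ᶠ y = toℕ x <ᵇ toℕ y

    <ᶠ-irrefl : ∀ x → (x <ᶠ x) ≡ false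
    <ᶠ-irrefl x = <ᵇ-irrefl (toℕ x)
      where
      <ᵇ-irrefl : ∀ m → (m <ᵇ m) ≡ false
      <ᵇ-irrefl zero    = refl
      <ᵇ-irrefl (suc m) = <ᵇ-irrefl m

    <ᶠ-trans : ∀ x y z → T (x <ᶠ y) → T (y <ᶠ z) → T (x <ᶠ z)
    <ᶠ-trans x y z p q = <⇒<ᵇ (<-trans (<ᵇ⇒< (toℕ x) (toℕ y) p) (<ᵇ⇒< (toℕ y) (toℕ z) q))

    <ᶠ-asym : ∀ {x y} → T (x <ᶠ y) → (y <ᶠ x) ≡ false
    <ᶠ-asym {x} {y} p with y <ᶠ x in eq
    ... | false = refl
    ... | true  = ⊥-elim (<-asym (<ᵇ⇒< (toℕ x) (toℕ y) p) (<ᵇ⇒< (toℕ y) (toℕ x) (subst T (sym eq) tt)))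

    Increasing : List (Fin n) → Set
    Increasing = AllPairs (λ x y → T (x <ᶠ y))

    allFin-increasing : Increasing (allFin n)
    allFin-increasing = tabulate⁺-< <⇒<ᵇ

    module _ (S : Fin n → Bool) where

      above : List (Fin n) → Fin n → ℕ
      above xs b = count (λ d → (b <ᶠ d) ∧ S d) xs

      count-∧-on-All : (L : Fin n → Bool) (ys : List (Fin n)) → All (T ∘ L) ys →
        count (λ d → L d ∧ S d) ys ≡ count S ys
      count-∧-on-All L ys a = count-cong-All ys (All.map (λ {c} p → cong (_∧ S c) (Equivalence.to T-≡ p)) a)

      above-cons : ∀ x ys → All (λ c → T (x <ᶠ c)) ys → All (λ c → above (x ∷ ys) c ≡ above ys c) ys
      above-cons x ys = All.map λ {c} x<c →
        trans (count-cons (λ d → (c <ᶠ d) ∧ S d) x ys) (cong (λ z → ind (z ∧ S x) + above ys c) (<ᶠ-asym {x} {c} x<c))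

      above-head : ∀ x ys → All (λ c → T (x <ᶠ c)) ys → above (x ∷ ys) x ≡ count S ys
      above-head x ys x<ys = trans (count-cons (λ d → (x <ᶠ d) ∧ S d) x ys)
        (trans (cong (λ z → ind (z ∧ S x) + above ys x) (<ᶠ-irrefl x)) (count-∧-on-All (x <ᶠ_) ys x<ys))

      hockey-stick : (L : Fin n → Bool) → (∀ {c d} → T (L c) → T (c <ᶠ d) → T (L d)) →
        (j : ℕ) (xs : List (Fin n)) → Increasing xs →
        sum (map (λ c → ind (L c ∧ S c) * (above xs c C j)) xs) ≡ count (λ d → L d ∧ S d) xs C suc j
      hockey-stick L up j [] [] = refl
      hockey-stick L up j (x ∷ ys) (x<ys ∷ inc) = begin
        ind (L x ∧ S x) * (above (x ∷ ys) x C j) + sum (map (λ c → ind (L c ∧ S c) * (above (x ∷ ys) c C j)) ys)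
          ≡⟨ cong₂ (λ a b → ind (L x ∧ S x) * (a C j) + b) (above-head x ys x<ys)
                   (sum-cong-All ys (All.map (λ {c} → cong (λ z → ind (L c ∧ S c) * (z C j))) (above-cons x ys x<ys))) ⟩
        ind (L x ∧ S x) * (count S ys C j) + sum (map (λ c → ind (L c ∧ S c) * (above ys c C j)) ys)
          ≡⟨ cong (ind (L x ∧ S x) * (count S ys C j) +_) (hockey-stick L up j ys inc) ⟩
        ind (L x ∧ S x) * (count S ys C j) + count LS ys C suc j
          ≡⟨ pascal (L x) (S x) refl ⟩
        (ind (L x ∧ S x) + count LS ys) C suc j
          ≡⟨ cong (_C suc j) (count-cons LS x ys) ⟨
        count LS (x ∷ ys) C suc j
          ∎
        where
        open ≡-Reasoning
        LS : Fin n → Bool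
        LS d = L d ∧ S d
        pascal : ∀ l s → L x ≡ l → ind (l ∧ s) * (count S ys C j) + count LS ys C suc j ≡ (ind (l ∧ s) + count LS ys) C suc j
        pascal false s _ = refl
        pascal true false _ = refl
        pascal true true Lx = begin
          1 * (count S ys C j) + count LS ys C suc j
            ≡⟨ cong₂ (λ a b → a + b C suc j) (*-identityˡ _) (count-∧-on-All L ys (All.map (up (subst T (sym Lx) tt)) x<ys)) ⟩
          count S ys C j + count S ys C suc j
            ≡⟨ nCk+nC[k+1]≡[n+1]C[k+1] (count S ys) j ⟩
          suc (count S ys) C suc j
            ≡⟨ cong (λ z → suc z C suc j) (count-∧-on-All L ys (All.map (up (subst T (sym Lx) tt)) x<ys)) ⟨
          suc (count LS ys) C suc j
            ∎

  Quadruple : ℕ → Set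
  Quadruple n = Fin n × Fin n × Fin n × Fin n

  quadruples : (n : ℕ) → List (Quadruple n)
  quadruples n = concatMap (λ a → concatMap (λ b → concatMap (λ c → map (λ d → (a , b , c , d)) V) V) V) V
    where
    V : List (Fin n)
    V = allFin n

  module _ {n : ℕ} where

    increasing : Quadruple n → Bool
    increasing (a , b , c , d) = (a <ᶠ b) ∧ (b <ᶠ c) ∧ (c <ᶠ d)

    within : (Fin n → Bool) → Quadruple n → Bool
    within S (a , b , c , d) = S a ∧ S b ∧ S c ∧ S d

    count-increasing-within : (S : Fin n → Bool) →
      count (λ q → increasing q ∧ within S q) (quadruples n) ≡ countV n S C 4
    count-increasing-within S = begin
      count P (quadruples n)                                                ≡⟨ count-concatMap P _ V ⟩
      sum (map (λ a → count P (concatMap (λ b → concatMap (λ c → map (λ d → (a , b , c , d)) V) V) V)) V)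
                                                                            ≡⟨ sum-cong fromFirst V ⟩
      sum (map (λ a → ind (true ∧ S a) * (above S V a C 3)) V)              ≡⟨ hockey-stick S (λ _ → true) _ 3 V allFin-increasing ⟩
      countV n S C 4                                                        ∎
      where
      open ≡-Reasoning
      V = allFin n
      P : Quadruple n → Bool
      P q = increasing q ∧ within S q
      L : Fin n → Fin n → Bool
      L a b = (a <ᶠ b) ∧ S b
      regroup : ∀ a b c d → P (a , b , c , d) ≡ S a ∧ (L a b ∧ (L b c ∧ L c d))
      regroup a b c d = solve 7 (λ u1 u2 u3 u4 u5 u6 u7 →
        (u2 ⊕ u4 ⊕ u6) ⊕ (u1 ⊕ u3 ⊕ u5 ⊕ u7) ⊜ u1 ⊕ ((u2 ⊕ u3) ⊕ ((u4 ⊕ u5) ⊕ (u6 ⊕ u7)))) refl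
        (S a) (a <ᶠ b) (S b) (b <ᶠ c) (S c) (c <ᶠ d) (S d)
      fromThird : ∀ a b c → count P (map (λ d → (a , b , c , d)) V) ≡ ind (S a) * (ind (L a b) * (ind (L b c) * (above S V c C 1)))
      fromThird a b c = begin
        count P (map (λ d → (a , b , c , d)) V)                   ≡⟨ count-map P _ V ⟩
        count (λ d → P (a , b , c , d)) V                         ≡⟨ count-cong (regroup a b c) V ⟩
        count (λ d → S a ∧ (L a b ∧ (L b c ∧ L c d))) V           ≡⟨ count-const-∧ (S a) _ V ⟩
        ind (S a) * count (λ d → L a b ∧ (L b c ∧ L c d)) V       ≡⟨ cong (ind (S a) *_) (count-const-∧ (L a b) _ V) ⟩
        ind (S a) * (ind (L a b) * count (λ d → L b c ∧ L c d) V) ≡⟨ cong (λ z → ind (S a) * (ind (L a b) * z)) (count-const-∧ (L b c) _ V) ⟩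
        ind (S a) * (ind (L a b) * (ind (L b c) * above S V c))   ≡⟨ cong (λ z → ind (S a) * (ind (L a b) * (ind (L b c) * z))) (nC1≡n _) ⟨
        ind (S a) * (ind (L a b) * (ind (L b c) * (above S V c C 1))) ∎
      fromSecond : ∀ a b → count P (concatMap (λ c → map (λ d → (a , b , c , d)) V) V) ≡ ind (S a) * (ind (L a b) * (above S V b C 2))
      fromSecond a b = begin
        count P (concatMap (λ c → map (λ d → (a , b , c , d)) V) V)                 ≡⟨ count-concatMap P _ V ⟩
        sum (map (λ c → count P (map (λ d → (a , b , c , d)) V)) V)                 ≡⟨ sum-cong (fromThird a b) V ⟩
        sum (map (λ c → ind (S a) * (ind (L a b) * (ind (L b c) * (above S V c C 1)))) V) ≡⟨ sum-*ˡ (ind (S a)) _ V ⟩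
        ind (S a) * sum (map (λ c → ind (L a b) * (ind (L b c) * (above S V c C 1))) V)   ≡⟨ cong (ind (S a) *_) (sum-*ˡ (ind (L a b)) _ V) ⟩
        ind (S a) * (ind (L a b) * sum (map (λ c → ind (L b c) * (above S V c C 1)) V))   ≡⟨ cong (λ z → ind (S a) * (ind (L a b) * z)) (hockey-stick S (b <ᶠ_) (λ {c} {d} → <ᶠ-trans b c d) 1 V allFin-increasing) ⟩
        ind (S a) * (ind (L a b) * (above S V b C 2))                                     ∎
      fromFirst : ∀ a → count P (concatMap (λ b → concatMap (λ c → map (λ d → (a , b , c , d)) V) V) V) ≡ ind (true ∧ S a) * (above S V a C 3)
      fromFirst a = begin
        count P (concatMap (λ b → concatMap (λ c → map (λ d → (a , b , c , d)) V) V) V)     ≡⟨ count-concatMap P _ V ⟩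
        sum (map (λ b → count P (concatMap (λ c → map (λ d → (a , b , c , d)) V) V)) V)     ≡⟨ sum-cong (fromSecond a) V ⟩
        sum (map (λ b → ind (S a) * (ind (L a b) * (above S V b C 2))) V)                   ≡⟨ sum-*ˡ (ind (S a)) _ V ⟩
        ind (S a) * sum (map (λ b → ind (L a b) * (above S V b C 2)) V)                     ≡⟨ cong (ind (S a) *_) (hockey-stick S (a <ᶠ_) (λ {c} {d} → <ᶠ-trans a c d) 2 V allFin-increasing) ⟩
        ind (S a) * (above S V a C 3)                                                       ∎

  module _ {n : ℕ} where

    private
      V : List (Fin n)
      V = allFin n

    length-allFin : length V ≡ n
    length-allFin = length-tabulate (λ i → i)

    count-const-allFin : (b : Bool) → count (λ _ → b) V ≤ ind b * n
    count-const-allFin b = subst (λ m → count (λ _ → b) V ≤ ind b * m) length-allFin (count-const b V)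

    count-quadruples-≤₁ : (p : Quadruple n → Bool) (K : ℕ) →
      (∀ a → count p (concatMap (λ b → concatMap (λ c → map (λ d → (a , b , c , d)) V) V) V) ≤ K) →
      count p (quadruples n) ≤ n * K
    count-quadruples-≤₁ p K h = subst (λ m → count p (quadruples n) ≤ m * K) length-allFin (count-concatMap-≤ p _ K h V)

    count-quadruples-≤₂ : (p : Quadruple n → Bool) (K : ℕ) →
      (∀ a b → count p (concatMap (λ c → map (λ d → (a , b , c , d)) V) V) ≤ K) →
      count p (quadruples n) ≤ n * (n * K)
    count-quadruples-≤₂ p K h = count-quadruples-≤₁ p (n * K) λ a →
      subst (λ m → count p (concatMap (λ b → concatMap (λ c → map (λ d → (a , b , c , d)) V) V) V) ≤ m * K)
        length-allFin (count-concatMap-≤ p _ K (h a) V)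

    count-quadruples-≤₃ : (p : Quadruple n → Bool) (K : ℕ) →
      (∀ a b c → count p (map (λ d → (a , b , c , d)) V) ≤ K) →
      count p (quadruples n) ≤ n * (n * (n * K))
    count-quadruples-≤₃ p K h = count-quadruples-≤₂ p (n * K) λ a b →
      subst (λ m → count p (concatMap (λ c → map (λ d → (a , b , c , d)) V) V) ≤ m * K)
        length-allFin (count-concatMap-≤ p _ K (h a b) V)

    module _ (R : Fin n → Fin n → Bool) where

      onAB onAC onAD onBC onBD onCD : Quadruple n → Bool
      onAB (a , b , c , d) = R a b
      onAC (a , b , c , d) = R a c
      onAD (a , b , c , d) = R a d
      onBC (a , b , c , d) = R b c
      onBD (a , b , c , d) = R b d
      onCD (a , b , c , d) = R c d

      onSomePair : Quadruple n → Bool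
      onSomePair (a , b , c , d) = R a b ∨ R a c ∨ R a d ∨ R b c ∨ R b d ∨ R c d

      module _ (h : ℕ) (R-≤ : ∀ x → count (R x) V ≤ h) where

        private
          slice-≤ : (x : Fin n) (p : Quadruple n → Bool) (g : Fin n → Quadruple n) →
            (∀ d → p (g d) ≡ R x d) → count p (map g V) ≤ h
          slice-≤ x p g e = ≤-trans (≤-reflexive (trans (count-map p g V) (count-cong e V))) (R-≤ x)

          const-slice-≤ : (B : Bool) (p : Quadruple n → Bool) (g : Fin n → Quadruple n) →
            (∀ d → p (g d) ≡ B) → count p (map g V) ≤ ind B * n
          const-slice-≤ B p g e = ≤-trans (≤-reflexive (trans (count-map p g V) (count-cong e V))) (count-const-allFin B)

          plane-≤ : (x : Fin n) (p : Quadruple n → Bool) (g : Fin n → Fin n → Quadruple n) →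
            (∀ c d → p (g c d) ≡ R x c) → count p (concatMap (λ c → map (g c) V) V) ≤ h * n
          plane-≤ x p g e = ≤-trans (count-concatMap-≤-count p _ (R x) n (λ c → const-slice-≤ (R x c) p (g c) (e c)) V)
                                    (*-monoˡ-≤ n (R-≤ x))

        count-onSomePair-≤ : count onSomePair (quadruples n) ≤ 6 * (n * n * n) * h
        count-onSomePair-≤ = begin
          count onSomePair Q
            ≤⟨ count-∨-≤ {p = onSomePair} {onAB} (λ { (a , b , c , d) t → t }) Q ⟩
          count onAB Q + count (λ { (a , b , c , d) → R a c ∨ R a d ∨ R b c ∨ R b d ∨ R c d }) Q
            ≤⟨ +-monoʳ-≤ (count onAB Q) (count-∨-≤ {q = onAC} (λ { (a , b , c , d) t → t }) Q) ⟩
          count onAB Q + (count onAC Q + count (λ { (a , b , c , d) → R a d ∨ R b c ∨ R b d ∨ R c d }) Q)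
            ≤⟨ +-monoʳ-≤ (count onAB Q) (+-monoʳ-≤ (count onAC Q) (count-∨-≤ {q = onAD} (λ { (a , b , c , d) t → t }) Q)) ⟩
          count onAB Q + (count onAC Q + (count onAD Q + count (λ { (a , b , c , d) → R b c ∨ R b d ∨ R c d }) Q))
            ≤⟨ +-monoʳ-≤ (count onAB Q) (+-monoʳ-≤ (count onAC Q) (+-monoʳ-≤ (count onAD Q)
                 (count-∨-≤ {q = onBC} (λ { (a , b , c , d) t → t }) Q))) ⟩
          count onAB Q + (count onAC Q + (count onAD Q + (count onBC Q + count (λ { (a , b , c , d) → R b d ∨ R c d }) Q)))
            ≤⟨ +-monoʳ-≤ (count onAB Q) (+-monoʳ-≤ (count onAC Q) (+-monoʳ-≤ (count onAD Q) (+-monoʳ-≤ (count onBC Q)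
                 (count-∨-≤ {q = onBD} {onCD} (λ { (a , b , c , d) t → t }) Q)))) ⟩
          count onAB Q + (count onAC Q + (count onAD Q + (count onBC Q + (count onBD Q + count onCD Q))))
            ≤⟨ +-mono-≤ ab (+-mono-≤ ac (+-mono-≤ ad (+-mono-≤ bc (+-mono-≤ bd cd)))) ⟩
          n * (h * (n * n)) + (n * (n * (h * n)) + (n * (n * (n * h)) + (n * (n * (h * n)) + (n * (n * (n * h)) + n * (n * (n * h))))))
            ≡⟨ six-terms n h ⟩
          6 * (n * n * n) * h ∎
          where
          open ≤-Reasoning
          Q : List (Quadruple n)
          Q = quadruples n
          six-terms : ∀ n h → n * (h * (n * n)) + (n * (n * (h * n)) + (n * (n * (n * h)) + (n * (n * (h * n))
                       + (n * (n * (n * h)) + n * (n * (n * h)))))) ≡ 6 * (n * n * n) * h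
          six-terms = ℕ-Solver.solve-∀
          ab : count onAB Q ≤ n * (h * (n * n))
          ab = count-quadruples-≤₁ onAB _ λ a →
            ≤-trans (count-concatMap-≤-count onAB _ (R a) (n * n) (λ b →
              ≤-trans (count-concatMap-≤-count onAB _ (λ _ → R a b) n (λ c → const-slice-≤ (R a b) onAB _ (λ d → refl)) V)
                      (≤-trans (*-monoˡ-≤ n (count-const-allFin (R a b))) (≤-reflexive (*-assoc (ind (R a b)) n n)))) V)
              (*-monoˡ-≤ (n * n) (R-≤ a))
          ac : count onAC Q ≤ n * (n * (h * n))
          ac = count-quadruples-≤₂ onAC _ λ a b → plane-≤ a onAC _ λ c d → refl
          bc : count onBC Q ≤ n * (n * (h * n))
          bc = count-quadruples-≤₂ onBC _ λ a b → plane-≤ b onBC _ λ c d → refl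
          ad : count onAD Q ≤ n * (n * (n * h))
          ad = count-quadruples-≤₃ onAD _ λ a b c → slice-≤ a onAD _ λ d → refl
          bd : count onBD Q ≤ n * (n * (n * h))
          bd = count-quadruples-≤₃ onBD _ λ a b c → slice-≤ b onBD _ λ d → refl
          cd : count onCD Q ≤ n * (n * (n * h))
          cd = count-quadruples-≤₃ onCD _ λ a b c → slice-≤ c onCD _ λ d → refl

module Labels where

  open import Defs using (inPart; _⊕_)
  open Counting using (ind; sum-cong)
  open import Data.Nat using (ℕ; _+_; _≡ᵇ_)
  open import Data.Nat.Properties using (≡ᵇ⇒≡)
  open import Data.Nat.ListAction using (sum)
  open import Data.Bool using (Bool; true; false; _∧_; _∨_; not; T)
  open import Data.Empty using (⊥)
  open import Data.Maybe using (Maybe; just; nothing)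
  open import Data.Fin using (Fin)
  open import Data.List.Base using (List; _∷_; map)
  open import Data.Bool.ListAction using (all; any)
  open import Data.List.Base using (allFin)
  open import Data.List.Membership.Propositional using (_∈_)
  open import Data.List.Membership.Propositional.Properties using (∈-allFin; ∈-map⁺)
  open import Data.List.Relation.Unary.All using (lookup)
  open import Data.List.Relation.Unary.All.Properties using (all⁺)
  open import Data.List.Relation.Unary.Any using (here; there)
  open import Relation.Binary.PropositionalEquality using (_≡_; refl)

  Label : Set
  Label = Maybe (Fin 5)

  labels : List Label
  labels = nothing ∷ map just (allFin 5)

  ∀-class : (f : Fin 5 → Bool) → T (all f (allFin 5)) → ∀ i → T (f i)
  ∀-class f t i = lookup (all⁺ f (allFin 5) t) (∈-allFin i)

  ∀-label : (f : Label → Bool) → T (all f labels) → ∀ l → T (f l)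
  ∀-label f t l = lookup (all⁺ f labels t) (member l)
    where
    member : ∀ l → l ∈ labels
    member nothing  = here refl
    member (just i) = there (∈-map⁺ just (∈-allFin i))

  ∀-labels⁴ : (f : Label → Label → Label → Label → Bool) →
    T (all (λ a → all (λ b → all (λ c → all (λ d → f a b c d) labels) labels) labels) labels) →
    ∀ a b c d → T (f a b c d)
  ∀-labels⁴ f t a b c d =
    ∀-label (f a b c) (∀-label (λ c → all (f a b c) labels)
      (∀-label (λ b → all (λ c → all (f a b c) labels) labels)
        (∀-label (λ a → all (λ b → all (λ c → all (f a b c) labels) labels) labels) t a) b) c) d

  Σ₅ : (Fin 5 → ℕ) → ℕ
  Σ₅ f = sum (map f (allFin 5))

  Σ₅-cong : ∀ {f g : Fin 5 → ℕ} → (∀ i → f i ≡ g i) → Σ₅ f ≡ Σ₅ g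
  Σ₅-cong e = sum-cong e (allFin 5)

  inPair : Fin 5 → Label → Bool
  inPair i l = inPart l i ∨ inPart l (i ⊕ 1)

  -- Condition (1) bounds the non-neighbours of a vertex among the vertices near it.
  near : Label → Label → Bool
  near nothing  _ = false
  near (just i) l = inPart l (i ⊕ 4) ∨ inPart l i ∨ inPart l (i ⊕ 1)

  all⁴ : (Label → Bool) → Label → Label → Label → Label → Bool
  all⁴ f a b c d = f a ∧ f b ∧ f c ∧ f d

  inSomePair : Label → Label → Label → Label → Bool
  inSomePair a b c d = any (λ i → all⁴ (inPair i) a b c d) (allFin 5)

  ind-inPair : ∀ i l → ind (inPair i l) ≡ ind (inPart l i) + ind (inPart l (i ⊕ 1))
  ind-inPair i l = ≡ᵇ⇒≡ _ _ (∀-class (λ i → check i l) (∀-label (λ l → all (λ i → check i l) (allFin 5)) _ l) i)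
    where
    check : Fin 5 → Label → Bool
    check i l = ind (inPair i l) ≡ᵇ ind (inPart l i) + ind (inPart l (i ⊕ 1))

  -- Two of the unions V_i ∪ V_{i+1} intersect in at most one class V_i, so a quadruple lying in
  -- some union is counted once by the union terms after removing the quadruples inside one class.
  inclusion-exclusion : ∀ a b c d →
    ind (inSomePair a b c d) + Σ₅ (λ i → ind (all⁴ (λ l → inPart l i) a b c d))
    ≡ Σ₅ (λ i → ind (all⁴ (inPair i) a b c d))
  inclusion-exclusion = λ a b c d → ≡ᵇ⇒≡ _ _ (∀-labels⁴ check _ a b c d)
    where
    check : Label → Label → Label → Label → Bool
    check a b c d = (ind (inSomePair a b c d) + Σ₅ (λ i → ind (all⁴ (λ l → inPart l i) a b c d)))
                    ≡ᵇ Σ₅ (λ i → ind (all⁴ (inPair i) a b c d))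

  inSomePair⇒pairwise-near : ∀ a b c d → T (inSomePair a b c d) →
    T (near a b ∧ near a c ∧ near a d ∧ near b c ∧ near b d ∧ near c d)
  inSomePair⇒pairwise-near a b c d = implies (∀-labels⁴ check _ a b c d)
    where
    check : Label → Label → Label → Label → Bool
    check a b c d = not (inSomePair a b c d) ∨ (near a b ∧ near a c ∧ near a d ∧ near b c ∧ near b d ∧ near c d)
    implies : ∀ {x y} → T (not x ∨ y) → T x → T y
    implies {true} t _ = t

  opposite-not-in-pair : ∀ i l → T (inPair i l) → T (inPart l (i ⊕ 3)) → ⊥
  opposite-not-in-pair i l = implies₂ (∀-class (λ i → check i l) (∀-label (λ l → all (λ i → check i l) (allFin 5)) _ l) i)
    where
    check : Fin 5 → Label → Bool
    check i l = not (inPair i l) ∨ not (inPart l (i ⊕ 3))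
    implies₂ : ∀ {a b} → T (not a ∨ not b) → T a → T b → ⊥
    implies₂ {true} {true} ()

  opposite-is-far : ∀ i j l → T (inPair i (just j)) → T (inPart l (i ⊕ 3)) →
    T (inPart l (j ⊕ 2) ∨ inPart l (j ⊕ 3))
  opposite-is-far i j l = implies₂
    (∀-class (λ j → check i j l) (∀-class (λ i → all (λ j → check i j l) (allFin 5))
      (∀-label (λ l → all (λ i → all (λ j → check i j l) (allFin 5)) (allFin 5)) _ l) i) j)
    where
    check : Fin 5 → Fin 5 → Label → Bool
    check i j l = not (inPair i (just j)) ∨ not (inPart l (i ⊕ 3)) ∨ inPart l (j ⊕ 2) ∨ inPart l (j ⊕ 3)
    implies₂ : ∀ {a b c} → T (not a ∨ not b ∨ c) → T a → T b → T c
    implies₂ {true} {true} t _ _ = t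

module PairUnions where

  open import Defs
  open Counting
  open Quadruples
  open Labels
  open import Data.Nat
  open import Data.Nat.Properties
  open import Data.Nat.Combinatorics using (_C_)
  open import Data.Bool using (Bool; true; false; _∧_; _∨_; not; T)
  open import Data.Bool.Properties using (T-∧; T-≡)
  open import Function using (Equivalence)
  open import Data.Unit using (tt)
  open import Data.Empty using (⊥-elim)
  open import Data.Maybe using (just; nothing)
  open import Data.Product using (_×_; _,_; proj₁; proj₂)
  open import Data.Fin using (Fin) renaming (_≟_ to _≟ᶠ_)
  open import Data.List using (List; _∷_; map)
  open import Data.List.Base using (allFin)
  open import Relation.Nullary using (yes; no)
  open import Relation.Binary.PropositionalEquality

  private
    T-∧-split : ∀ {a b} → T (a ∧ b) → T a × T b
    T-∧-split = Equivalence.to T-∧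

    T-∧³ : ∀ {a b c} → T (a ∧ b ∧ c) → T a × T b × T c
    T-∧³ {true} {true} {true} _ = tt , tt , tt

    T-∧⁶ : ∀ {a b c d e f} → T (a ∧ b ∧ c ∧ d ∧ e ∧ f) → T a × T b × T c × T d × T e × T f
    T-∧⁶ {true} {true} {true} {true} {true} {true} _ = tt , tt , tt , tt , tt , tt

    allAdjacent-or-defect : ∀ (l1 l2 l3 n1 n2 n3 n4 n5 n6 f1 f2 f3 f4 f5 f6 e1 e2 e3 e4 e5 e6 : Bool) →
      l1 ≡ true → l2 ≡ true → l3 ≡ true →
      n1 ≡ true → n2 ≡ true → n3 ≡ true → n4 ≡ true → n5 ≡ true → n6 ≡ true →
      f1 ≡ false → f2 ≡ false → f3 ≡ false → f4 ≡ false → f5 ≡ false → f6 ≡ false →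
      T ((l1 ∧ l2 ∧ l3 ∧ e1 ∧ e2 ∧ e3 ∧ e4 ∧ e5 ∧ e6)
         ∨ (not f1 ∧ n1 ∧ not e1) ∨ (not f2 ∧ n2 ∧ not e2) ∨ (not f3 ∧ n3 ∧ not e3)
         ∨ (not f4 ∧ n4 ∧ not e4) ∨ (not f5 ∧ n5 ∧ not e5) ∨ (not f6 ∧ n6 ∧ not e6))
    allAdjacent-or-defect _ _ _ _ _ _ _ _ _ _ _ _ _ _ _ e1 e2 e3 e4 e5 e6
      refl refl refl refl refl refl refl refl refl refl refl refl refl refl refl = all-or-some-false e1 e2 e3 e4 e5 e6
      where
      all-or-some-false : ∀ e1 e2 e3 e4 e5 e6 →
        T ((e1 ∧ e2 ∧ e3 ∧ e4 ∧ e5 ∧ e6) ∨ not e1 ∨ not e2 ∨ not e3 ∨ not e4 ∨ not e5 ∨ not e6)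
      all-or-some-false false _ _ _ _ _ = tt
      all-or-some-false true false _ _ _ _ = tt
      all-or-some-false true true false _ _ _ = tt
      all-or-some-false true true true false _ _ = tt
      all-or-some-false true true true true false _ = tt
      all-or-some-false true true true true true false = tt
      all-or-some-false true true true true true true = tt

  module _ {n : ℕ} (G : Graph n) (P : Partition n) where

    private
      V : List (Fin n)
      V = allFin n

    size : Fin 5 → ℕ
    size = partSize P

    -- The predicate counted by t4, so t4 G is count isK4 (quadruples n) by definition.
    isK4 : Quadruple n → Bool
    isK4 (a , b , c , d) = (a <ᶠ b) ∧ (b <ᶠ c) ∧ (c <ᶠ d) ∧
      adj G a b ∧ adj G a c ∧ adj G a d ∧ adj G b c ∧ adj G b d ∧ adj G c d

    size-inPair : ∀ i → countV n (λ v → inPair i (P v)) ≡ size i + size (i ⊕ 1)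
    size-inPair i = count-split (λ v → ind-inPair i (P v)) V

    withinSomePair : Quadruple n → Bool
    withinSomePair (a , b , c , d) = inSomePair (P a) (P b) (P c) (P d)

    count-withinSomePair : count (λ q → increasing q ∧ withinSomePair q) (quadruples n) + Σ₅ (λ i → size i C 4)
                     ≡ Σ₅ (λ i → (size i + size (i ⊕ 1)) C 4)
    count-withinSomePair = begin
      count (λ q → increasing q ∧ withinSomePair q) Q + Σ₅ (λ i → size i C 4)
        ≡⟨ cong (count (λ q → increasing q ∧ withinSomePair q) Q +_) (Σ₅-cong (λ i → count-increasing-within (inClass i))) ⟨
      countSum separate Q
        ≡⟨ countSum-cong separate byUnion perQuadruple Q ⟩
      Σ₅ (λ i → count (λ q → increasing q ∧ within (inUnion i) q) Q)
        ≡⟨ Σ₅-cong (λ i → trans (count-increasing-within (inUnion i)) (cong (_C 4) (size-inPair i))) ⟩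
      Σ₅ (λ i → (size i + size (i ⊕ 1)) C 4) ∎
      where
      open ≡-Reasoning
      Q : List (Quadruple n)
      Q = quadruples n
      inClass inUnion : Fin 5 → Fin n → Bool
      inClass i v = inPart (P v) i
      inUnion i v = inPair i (P v)
      guarded : ∀ s a b c d →
        ind (s ∧ inSomePair a b c d) + Σ₅ (λ i → ind (s ∧ all⁴ (λ l → inPart l i) a b c d))
        ≡ Σ₅ (λ i → ind (s ∧ all⁴ (inPair i) a b c d))
      guarded false a b c d = refl
      guarded true  a b c d = inclusion-exclusion a b c d
      separate byUnion : List (Quadruple n → Bool)
      separate = (λ q → increasing q ∧ withinSomePair q) ∷ map (λ i q → increasing q ∧ within (inClass i) q) (allFin 5)
      byUnion = map (λ i q → increasing q ∧ within (inUnion i) q) (allFin 5)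
      perQuadruple : ∀ q → indSum separate q ≡ indSum byUnion q
      perQuadruple (a , b , c , d) = guarded (increasing (a , b , c , d)) (P a) (P b) (P c) (P d)

    -- Conjuncts ordered as in Cond1, whose first component is then literally the bound below.
    nearNonNeighbour : Fin n → Fin n → Bool
    nearNonNeighbour x y = not (y =ᶠ x) ∧ near (P x) (P y) ∧ not (adj G x y)

    nearNonNeighbours-≤ : (h : ℕ) → Cond1 G P h → ∀ x → count (nearNonNeighbour x) V ≤ h
    nearNonNeighbours-≤ h cond1 x with P x in e
    ... | just i  = proj₁ (cond1 x i e)
    ... | nothing = ≤-trans (count-mono {q = λ _ → false} (λ y → false-in-middle (not (y =ᶠ x)) (not (adj G x y))) V)
                            (≤-trans (count-const-allFin {n} false) z≤n)
      where
      false-in-middle : ∀ b c → T (b ∧ false ∧ c) → T false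
      false-in-middle true  _ t = t
      false-in-middle false _ t = t

    K4-or-defect : ∀ q → T (increasing q ∧ withinSomePair q) → T (isK4 q ∨ onSomePair nearNonNeighbour q)
    K4-or-defect (a , b , c , d) t with T-∧³ {a <ᶠ b} (proj₁ (T-∧-split t))
    ... | ab , bc , cd
      with T-∧⁶ {near (P a) (P b)} (inSomePair⇒pairwise-near (P a) (P b) (P c) (P d) (proj₂ (T-∧-split t)))
    ... | nab , nac , nad , nbc , nbd , ncd =
      allAdjacent-or-defect (a <ᶠ b) (b <ᶠ c) (c <ᶠ d)
        (near (P a) (P b)) (near (P a) (P c)) (near (P a) (P d)) (near (P b) (P c)) (near (P b) (P d)) (near (P c) (P d))
        (b =ᶠ a) (c =ᶠ a) (d =ᶠ a) (c =ᶠ b) (d =ᶠ b) (d =ᶠ c)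
        (adj G a b) (adj G a c) (adj G a d) (adj G b c) (adj G b d) (adj G c d)
        (T⇒≡ ab) (T⇒≡ bc) (T⇒≡ cd) (T⇒≡ nab) (T⇒≡ nac) (T⇒≡ nad) (T⇒≡ nbc) (T⇒≡ nbd) (T⇒≡ ncd)
        (distinct a b ab) (distinct a c ac) (distinct a d (<ᶠ-trans a c d ac cd)) (distinct b c bc)
        (distinct b d (<ᶠ-trans b c d bc cd)) (distinct c d cd)
      where
      ac : T (a <ᶠ c)
      ac = <ᶠ-trans a b c ab bc
      T⇒≡ : ∀ {x} → T x → x ≡ true
      T⇒≡ = Equivalence.to T-≡
      distinct : ∀ x y → T (x <ᶠ y) → (y =ᶠ x) ≡ false
      distinct x y x<y with y ≟ᶠ x
      ... | no _     = refl
      ... | yes refl = ⊥-elim (subst T (<ᶠ-irrefl x) x<y)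

    consecutive-pairs-bound : (h : ℕ) → Cond1 G P h →
      Σ₅ (λ i → (size i + size (i ⊕ 1)) C 4) ≤ t4 G + 6 * (n * n * n) * h + Σ₅ (λ i → size i C 4)
    consecutive-pairs-bound h cond1 = begin
      Σ₅ (λ i → (size i + size (i ⊕ 1)) C 4)
        ≡⟨ count-withinSomePair ⟨
      count (λ q → increasing q ∧ withinSomePair q) (quadruples n) + Σ₅ (λ i → size i C 4)
        ≤⟨ +-monoˡ-≤ _ (count-∨-≤ K4-or-defect (quadruples n)) ⟩
      t4 G + count (onSomePair nearNonNeighbour) (quadruples n) + Σ₅ (λ i → size i C 4)
        ≤⟨ +-monoˡ-≤ _ (+-monoʳ-≤ (t4 G) (count-onSomePair-≤ nearNonNeighbour h (nearNonNeighbours-≤ h cond1))) ⟩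
      t4 G + 6 * (n * n * n) * h + Σ₅ (λ i → size i C 4) ∎
      where open ≤-Reasoning

module Cliques where

  open import Defs hiding (sym)
  open Counting
  open Labels
  open import Data.Nat
  open import Data.Nat.Properties
  open import Data.Bool using (Bool; true; false; _∧_; _∨_; not; T)
  open import Data.Bool.Properties using (T-∧)
  open import Function using (Equivalence)
  open import Data.Empty using (⊥)
  open import Data.Maybe using (just)
  open import Data.Product using (_×_; _,_; proj₂)
  open import Data.Fin using (Fin)
  open import Data.List.Base using (allFin)
  open import Relation.Binary.PropositionalEquality

  private
    adjacent-to-neither : ∀ {c a b} → T c → T (not ((c ∧ a) ∨ (c ∧ b))) → a ≡ false × b ≡ false
    adjacent-to-neither {true} {false} {false} _ _ = refl , refl

    no-triangle-complement : ∀ {a b c} → a ≡ false → b ≡ false → c ≡ false → T (a ∨ b ∨ c) → ⊥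
    no-triangle-complement refl refl refl ()

  module _ {n : ℕ} (G : Graph n) (P : Partition n) (h : ℕ) (i : Fin 5) where

    inOpposite : Fin n → Bool
    inOpposite x = inPart (P x) (i ⊕ 3)

    opposite-neighbours-≤ : Cond1 G P h → ∀ u → T (inPair i (P u)) →
      count (λ x → inOpposite x ∧ adj G u x) (allFin n) ≤ h
    opposite-neighbours-≤ cond1 u u∈pair with P u in e
    ... | just j = ≤-trans (count-mono far-neighbour (allFin n)) (proj₂ (cond1 u j e))
      where
      far-neighbour : ∀ x → T (inOpposite x ∧ adj G u x) → T ((inPart (P x) (j ⊕ 2) ∨ inPart (P x) (j ⊕ 3)) ∧ adj G u x)
      far-neighbour x t with Equivalence.to T-∧ t
      ... | x∈opp , ux = Equivalence.from T-∧ (opposite-is-far i j (P x) u∈pair x∈opp , ux)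

    consecutive-union-clique : IndepAtMost2 G → Cond1 G P h → h + h < partSize P (i ⊕ 3) →
      UnionClique G P i (i ⊕ 1)
    consecutive-union-clique α≤2 cond1 big u w u≢w u∈pair w∈pair with adj G u w in e
    ... | true  = _
    ... | false with count-pigeonhole inOpposite (λ x → inOpposite x ∧ adj G u x) (λ x → inOpposite x ∧ adj G w x) (allFin n)
                       (≤-trans (s≤s (+-mono-≤ (opposite-neighbours-≤ cond1 u u∈pair) (opposite-neighbours-≤ cond1 w w∈pair))) big)
    ...   | x , x∈opp , neither with adjacent-to-neither x∈opp neither
    ...     | ux , wx = no-triangle-complement e wx ux (α≤2 u w x u≢w (apart w∈pair) (apart u∈pair))
      where
      apart : ∀ {v} → T (inPair i (P v)) → v ≢ x
      apart v∈pair refl = opposite-not-in-pair i (P x) v∈pair x∈opp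

module Binomial where

  open import Data.Nat
  open import Data.Nat.Properties
  open import Data.Nat.Combinatorics using (_C_; nCk+nC[k+1]≡[n+1]C[k+1]; nC1≡n)
  open import Relation.Binary.PropositionalEquality
  open import Data.List.Base using ([]; _∷_)
  import Data.Nat.Tactic.RingSolver as ℕ-Solver

  _⁴ : ℕ → ℕ
  m ⁴ = (m * m) * (m * m)

  _³ : ℕ → ℕ
  m ³ = m * m * m

  private
    2*C2 : ∀ m → 2 * (suc m C 2) ≡ suc m * m
    2*C2 zero    = refl
    2*C2 (suc m) = begin
      2 * (suc (suc m) C 2)                  ≡⟨ cong (2 *_) (nCk+nC[k+1]≡[n+1]C[k+1] (suc m) 1) ⟨
      2 * (suc m C 1 + suc m C 2)            ≡⟨ *-distribˡ-+ 2 (suc m C 1) (suc m C 2) ⟩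
      2 * (suc m C 1) + 2 * (suc m C 2)      ≡⟨ cong₂ _+_ (cong (2 *_) (nC1≡n (suc m))) (2*C2 m) ⟩
      2 * suc m + suc m * m                  ≡⟨ ℕ-Solver.solve (m ∷ []) ⟩
      suc (suc m) * suc m                    ∎
      where open ≡-Reasoning

    6*C3 : ∀ m → 6 * (suc (suc m) C 3) ≡ suc (suc m) * suc m * m
    6*C3 zero    = refl
    6*C3 (suc m) = begin
      6 * (suc (suc (suc m)) C 3)                       ≡⟨ cong (6 *_) (nCk+nC[k+1]≡[n+1]C[k+1] (suc (suc m)) 2) ⟨
      6 * (suc (suc m) C 2 + suc (suc m) C 3)           ≡⟨ *-distribˡ-+ 6 (suc (suc m) C 2) _ ⟩
      6 * (suc (suc m) C 2) + 6 * (suc (suc m) C 3)     ≡⟨ cong (_+ 6 * (suc (suc m) C 3)) (*-assoc 3 2 (suc (suc m) C 2)) ⟩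
      3 * (2 * (suc (suc m) C 2)) + 6 * (suc (suc m) C 3) ≡⟨ cong₂ (λ a b → 3 * a + b) (2*C2 (suc m)) (6*C3 m) ⟩
      3 * (suc (suc m) * suc m) + suc (suc m) * suc m * m ≡⟨ ℕ-Solver.solve (m ∷ []) ⟩
      suc (suc (suc m)) * suc (suc m) * suc m           ∎
      where open ≡-Reasoning

    24*C4 : ∀ m → 24 * (suc (suc (suc m)) C 4) ≡ suc (suc (suc m)) * suc (suc m) * suc m * m
    24*C4 zero    = refl
    24*C4 (suc m) = begin
      24 * (suc (suc (suc (suc m))) C 4)                           ≡⟨ cong (24 *_) (nCk+nC[k+1]≡[n+1]C[k+1] (suc (suc (suc m))) 3) ⟨
      24 * (suc (suc (suc m)) C 3 + suc (suc (suc m)) C 4)         ≡⟨ *-distribˡ-+ 24 (suc (suc (suc m)) C 3) _ ⟩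
      24 * (suc (suc (suc m)) C 3) + 24 * (suc (suc (suc m)) C 4)  ≡⟨ cong (_+ 24 * (suc (suc (suc m)) C 4)) (*-assoc 4 6 (suc (suc (suc m)) C 3)) ⟩
      4 * (6 * (suc (suc (suc m)) C 3)) + 24 * (suc (suc (suc m)) C 4)
        ≡⟨ cong₂ (λ a b → 4 * a + b) (6*C3 (suc m)) (24*C4 m) ⟩
      4 * (suc (suc (suc m)) * suc (suc m) * suc m) + suc (suc (suc m)) * suc (suc m) * suc m * m
        ≡⟨ ℕ-Solver.solve (m ∷ []) ⟩
      suc (suc (suc (suc m))) * suc (suc (suc m)) * suc (suc m) * suc m ∎
      where open ≡-Reasoning

  24*[mC4]≤m⁴ : ∀ m → 24 * (m C 4) ≤ m ⁴
  24*[mC4]≤m⁴ 0 = z≤n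
  24*[mC4]≤m⁴ 1 = z≤n
  24*[mC4]≤m⁴ 2 = z≤n
  24*[mC4]≤m⁴ (suc (suc (suc k))) = begin
    24 * ((3 + k) C 4)                                           ≡⟨ 24*C4 k ⟩
    (3 + k) * (2 + k) * (1 + k) * k                              ≤⟨ m≤m+n _ _ ⟩
    (3 + k) * (2 + k) * (1 + k) * k + (6 * k ³ + 43 * (k * k) + 102 * k + 81) ≡⟨ expand k ⟩
    (3 + k) ⁴                                                    ∎
    where
    open ≤-Reasoning
    expand : ∀ k → (3 + k) * (2 + k) * (1 + k) * k + (6 * (k * k * k) + 43 * (k * k) + 102 * k + 81)
                   ≡ ((3 + k) * (3 + k)) * ((3 + k) * (3 + k))
    expand = ℕ-Solver.solve-∀

  m⁴≤24*[mC4]+6m³ : ∀ m → m ⁴ ≤ 24 * (m C 4) + 6 * m ³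
  m⁴≤24*[mC4]+6m³ 0 = z≤n
  m⁴≤24*[mC4]+6m³ 1 = s≤s z≤n
  m⁴≤24*[mC4]+6m³ 2 = ≤ᵇ⇒≤ 16 48 _
  m⁴≤24*[mC4]+6m³ (suc (suc (suc k))) = begin
    (3 + k) ⁴                                                    ≤⟨ m≤m+n _ _ ⟩
    (3 + k) ⁴ + (11 * (k * k) + 60 * k + 81)                     ≡⟨ expand k ⟩
    (3 + k) * (2 + k) * (1 + k) * k + 6 * (3 + k) ³              ≡⟨ cong (_+ 6 * (3 + k) ³) (24*C4 k) ⟨
    24 * ((3 + k) C 4) + 6 * (3 + k) ³                           ∎
    where
    open ≤-Reasoning
    expand : ∀ k → ((3 + k) * (3 + k)) * ((3 + k) * (3 + k)) + (11 * (k * k) + 60 * k + 81)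
                   ≡ (3 + k) * (2 + k) * (1 + k) * k + 6 * ((3 + k) * (3 + k) * (3 + k))
    expand = ℕ-Solver.solve-∀

module QuarticStability where

  open Binomial using (_⁴)
  open import Data.Nat as ℕ using (ℕ; zero; suc; z≤n)
  import Data.Nat.Properties as ℕ
  open import Data.Integer as ℤ using (ℤ; +_; -[1+_]; _+_; _*_; _-_; ∣_∣; _⊖_; 0ℤ)
  open import Data.Integer.Properties
    using (pos-*; abs-*; ∣i+j∣≤∣i∣+∣j∣; ∣i-j∣≤∣i∣+∣j∣; ⊖-≥; m-n≡m⊖n; +-injective; [1+m]⊖[1+n]≡m⊖n)
  open import Data.Product using (Σ; _,_; proj₁; proj₂)
  open import Relation.Binary.PropositionalEquality
  import Data.Nat.Tactic.RingSolver as ℕ-Solver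
  import Data.Integer.Tactic.RingSolver as ℤ-Solver

  quartic : ℤ → ℤ
  quartic z = (z * z) * (z * z)

  +-quartic : ∀ a → + (a ⁴) ≡ quartic (+ a)
  +-quartic a = trans (pos-* (a ℕ.* a) (a ℕ.* a)) (cong₂ _*_ (pos-* a a) (pos-* a a))

  ∣+m-+n∣≡∣m-n∣ : ∀ m n → ∣ + m - + n ∣ ≡ ℕ.∣ m - n ∣
  ∣+m-+n∣≡∣m-n∣ m n = trans (cong ∣_∣ (m-n≡m⊖n m n)) (∣⊖∣≡∣-∣ m n)
    where
    ∣⊖∣≡∣-∣ : ∀ m n → ∣ m ⊖ n ∣ ≡ ℕ.∣ m - n ∣
    ∣⊖∣≡∣-∣ zero    zero    = refl
    ∣⊖∣≡∣-∣ zero    (suc n) = refl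
    ∣⊖∣≡∣-∣ (suc m) zero    = refl
    ∣⊖∣≡∣-∣ (suc m) (suc n) = trans (cong ∣_∣ ([1+m]⊖[1+n]≡m⊖n m n)) (∣⊖∣≡∣-∣ m n)

  ∣z∣*∣z∣≡z*z : ∀ z → + (∣ z ∣ ℕ.* ∣ z ∣) ≡ z * z
  ∣z∣*∣z∣≡z*z (+ k)    = pos-* k k
  ∣z∣*∣z∣≡z*z -[1+ k ] = refl

  NonNeg : ℤ → Set
  NonNeg x = Σ ℕ λ m → x ≡ + m

  NonNeg-+ : ∀ {x y} → NonNeg x → NonNeg y → NonNeg (x + y)
  NonNeg-+ (m , refl) (k , refl) = m ℕ.+ k , refl

  NonNeg-* : ∀ {x y} → NonNeg x → NonNeg y → NonNeg (x * y)
  NonNeg-* (m , refl) (k , refl) = m ℕ.* k , sym (pos-* m k)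

  NonNeg-∸ : ∀ {m n : ℕ} → n ℕ.≤ m → NonNeg (+ m - + n)
  NonNeg-∸ {m} {n} n≤m = m ℕ.∸ n , trans (m-n≡m⊖n m n) (⊖-≥ n≤m)

  NonNeg-B+ : ∀ (z : ℤ) (B : ℕ) → ∣ z ∣ ℕ.≤ B → NonNeg (+ B + z)
  NonNeg-B+ (+ k)    B _  = B ℕ.+ k , refl
  NonNeg-B+ -[1+ k ] B k<B = B ℕ.∸ suc k , ⊖-≥ k<B

  NonNeg-B- : ∀ (z : ℤ) (B : ℕ) → ∣ z ∣ ℕ.≤ B → NonNeg (+ B - z)
  NonNeg-B- (+ k)    B k≤B = NonNeg-∸ k≤B
  NonNeg-B- -[1+ k ] B _   = B ℕ.+ suc k , refl

  quartic-Lipschitz : ∀ (X Y : ℤ) (M u : ℕ) → ∣ X ∣ ℕ.≤ M → ∣ X - Y ∣ ℕ.≤ u → u ℕ.≤ M →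
    ∣ quartic X - quartic Y ∣ ℕ.≤ 32 ℕ.* (M ℕ.* M ℕ.* M) ℕ.* u
  quartic-Lipschitz X Y M u X≤M X-Y≤u u≤M = begin
    ∣ quartic X - quartic Y ∣
      ≡⟨ cong ∣_∣ (factor X Y) ⟩
    ∣ (X - Y) * (X * X * X + (X * X * Y + (X * Y * Y + Y * Y * Y))) ∣
      ≡⟨ abs-* (X - Y) _ ⟩
    ∣ X - Y ∣ ℕ.* ∣ X * X * X + (X * X * Y + (X * Y * Y + Y * Y * Y)) ∣
      ≤⟨ ℕ.*-mono-≤ X-Y≤u cubic-sum-≤ ⟩
    u ℕ.* (W³ ℕ.+ (W³ ℕ.+ (W³ ℕ.+ W³)))
      ≡⟨ rearrange u M ⟩
    32 ℕ.* (M ℕ.* M ℕ.* M) ℕ.* u ∎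
    where
    open ℕ.≤-Reasoning
    factor : ∀ X Y → (X * X) * (X * X) - (Y * Y) * (Y * Y) ≡ (X - Y) * (X * X * X + (X * X * Y + (X * Y * Y + Y * Y * Y)))
    factor = ℤ-Solver.solve-∀
    rearrange : ∀ u M → u ℕ.* ((M ℕ.+ M) ℕ.* (M ℕ.+ M) ℕ.* (M ℕ.+ M) ℕ.+ ((M ℕ.+ M) ℕ.* (M ℕ.+ M) ℕ.* (M ℕ.+ M)
      ℕ.+ ((M ℕ.+ M) ℕ.* (M ℕ.+ M) ℕ.* (M ℕ.+ M) ℕ.+ (M ℕ.+ M) ℕ.* (M ℕ.+ M) ℕ.* (M ℕ.+ M))))
      ≡ 32 ℕ.* (M ℕ.* M ℕ.* M) ℕ.* u
    rearrange = ℕ-Solver.solve-∀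
    Y≡X-[X-Y] : ∀ X Y → Y ≡ X - (X - Y)
    Y≡X-[X-Y] = ℤ-Solver.solve-∀
    W W³ : ℕ
    W = M ℕ.+ M
    W³ = W ℕ.* W ℕ.* W
    X≤W : ∣ X ∣ ℕ.≤ W
    X≤W = ℕ.≤-trans X≤M (ℕ.m≤m+n M M)
    Y≤W : ∣ Y ∣ ℕ.≤ W
    Y≤W = begin
      ∣ Y ∣             ≡⟨ cong ∣_∣ (Y≡X-[X-Y] X Y) ⟩
      ∣ X - (X - Y) ∣   ≤⟨ ∣i-j∣≤∣i∣+∣j∣ X (X - Y) ⟩
      ∣ X ∣ ℕ.+ ∣ X - Y ∣ ≤⟨ ℕ.+-mono-≤ X≤M (ℕ.≤-trans X-Y≤u u≤M) ⟩
      W                 ∎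
    product-≤ : ∀ a b c → ∣ a ∣ ℕ.≤ W → ∣ b ∣ ℕ.≤ W → ∣ c ∣ ℕ.≤ W → ∣ a * b * c ∣ ℕ.≤ W³
    product-≤ a b c pa pb pc = begin
      ∣ a * b * c ∣                  ≡⟨ trans (abs-* (a * b) c) (cong (ℕ._* ∣ c ∣) (abs-* a b)) ⟩
      ∣ a ∣ ℕ.* ∣ b ∣ ℕ.* ∣ c ∣      ≤⟨ ℕ.*-mono-≤ (ℕ.*-mono-≤ pa pb) pc ⟩
      W³                             ∎
    cubic-sum-≤ : ∣ X * X * X + (X * X * Y + (X * Y * Y + Y * Y * Y)) ∣ ℕ.≤ W³ ℕ.+ (W³ ℕ.+ (W³ ℕ.+ W³))
    cubic-sum-≤ =
      ℕ.≤-trans (∣i+j∣≤∣i∣+∣j∣ (X * X * X) _) (ℕ.+-mono-≤ (product-≤ X X X X≤W X≤W X≤W)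
      (ℕ.≤-trans (∣i+j∣≤∣i∣+∣j∣ (X * X * Y) _) (ℕ.+-mono-≤ (product-≤ X X Y X≤W X≤W Y≤W)
      (ℕ.≤-trans (∣i+j∣≤∣i∣+∣j∣ (X * Y * Y) _) (ℕ.+-mono-≤ (product-≤ X Y Y X≤W Y≤W Y≤W) (product-≤ Y Y Y Y≤W Y≤W Y≤W))))))

  -- With D = a₂ - n, the configuration (n, n - D, n + D, n - D, n + D) has pair sums
  -- (2n - D, 2n, 2n, 2n, 2n + D), and Σ (pair sum)⁴ - Σ (class)⁴ = 75 n⁴ + 6 n² D² + 2 D² (9 n² - D²).
  -- Each bracket below compares a quartic of the actual sizes with that of this configuration.
  certificate : ∀ (N A0 A1 A2 A3 A4 B : ℤ) →
    ((((A0 + A1) * (A0 + A1)) * ((A0 + A1) * (A0 + A1)) + ((A1 + A2) * (A1 + A2)) * ((A1 + A2) * (A1 + A2))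
      + ((A2 + A3) * (A2 + A3)) * ((A2 + A3) * (A2 + A3)) + ((A3 + A4) * (A3 + A4)) * ((A3 + A4) * (A3 + A4))
      + ((A4 + A0) * (A4 + A0)) * ((A4 + A0) * (A4 + A0)))
     + (B + B + B + B + B + B + B + B + B + B))
    ≡ ((A0 * A0) * (A0 * A0) + (A1 * A1) * (A1 * A1) + (A2 * A2) * (A2 * A2) + (A3 * A3) * (A3 * A3) + (A4 * A4) * (A4 * A4)
       + + 75 * ((N * N) * (N * N)) + + 6 * (N * N) * ((A2 - N) * (A2 - N)))
      + ((B + (((A0 + A1) * (A0 + A1)) * ((A0 + A1) * (A0 + A1)) - ((N + N - (A2 - N)) * (N + N - (A2 - N))) * ((N + N - (A2 - N)) * (N + N - (A2 - N)))))
        + (B + (((A1 + A2) * (A1 + A2)) * ((A1 + A2) * (A1 + A2)) - ((N + N) * (N + N)) * ((N + N) * (N + N))))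
        + (B + (((A2 + A3) * (A2 + A3)) * ((A2 + A3) * (A2 + A3)) - ((N + N) * (N + N)) * ((N + N) * (N + N))))
        + (B + (((A3 + A4) * (A3 + A4)) * ((A3 + A4) * (A3 + A4)) - ((N + N) * (N + N)) * ((N + N) * (N + N))))
        + (B + (((A4 + A0) * (A4 + A0)) * ((A4 + A0) * (A4 + A0)) - ((N + N + (A2 - N)) * (N + N + (A2 - N))) * ((N + N + (A2 - N)) * (N + N + (A2 - N)))))
        + (B - ((A0 * A0) * (A0 * A0) - (N * N) * (N * N)))
        + (B - ((A1 * A1) * (A1 * A1) - ((N - (A2 - N)) * (N - (A2 - N))) * ((N - (A2 - N)) * (N - (A2 - N)))))
        + (B - ((A2 * A2) * (A2 * A2) - ((N + (A2 - N)) * (N + (A2 - N))) * ((N + (A2 - N)) * (N + (A2 - N)))))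
        + (B - ((A3 * A3) * (A3 * A3) - ((N - (A2 - N)) * (N - (A2 - N))) * ((N - (A2 - N)) * (N - (A2 - N)))))
        + (B - ((A4 * A4) * (A4 * A4) - ((N + (A2 - N)) * (N + (A2 - N))) * ((N + (A2 - N)) * (N + (A2 - N)))))
        + + 2 * ((A2 - N) * (A2 - N)) * (+ 9 * (N * N) - (A2 - N) * (A2 - N)))
  certificate = ℤ-Solver.solve-∀

  private
    gap01 : ∀ N A0 A1 A2 → (A0 + A1) - (N + N - (A2 - N)) ≡ (A0 - N) + (A1 + A2 - (N + N))
    gap01 = ℤ-Solver.solve-∀
    gap40 : ∀ N A0 A2 A3 A4 → (A4 + A0) - (N + N + (A2 - N)) ≡ (A3 + A4 - (N + N)) - (A2 + A3 - (N + N)) + (A0 - N)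
    gap40 = ℤ-Solver.solve-∀
    gap1 : ∀ N A1 A2 → A1 - (N - (A2 - N)) ≡ A1 + A2 - (N + N)
    gap1 = ℤ-Solver.solve-∀
    gap2 : ∀ N A2 → A2 - (N + (A2 - N)) ≡ 0ℤ
    gap2 = ℤ-Solver.solve-∀
    gap3 : ∀ N A2 A3 → A3 - (N - (A2 - N)) ≡ A2 + A3 - (N + N)
    gap3 = ℤ-Solver.solve-∀
    gap4 : ∀ N A2 A3 A4 → A4 - (N + (A2 - N)) ≡ (A3 + A4 - (N + N)) - (A2 + A3 - (N + N))
    gap4 = ℤ-Solver.solve-∀

  deviation : (n a0 a1 a2 a3 a4 : ℕ) → ℕ
  deviation n a0 a1 a2 a3 a4 = ℕ.∣ a0 - n ∣ ℕ.+ ℕ.∣ a1 ℕ.+ a2 - n ℕ.+ n ∣ ℕ.+ ℕ.∣ a2 ℕ.+ a3 - n ℕ.+ n ∣ ℕ.+ ℕ.∣ a3 ℕ.+ a4 - n ℕ.+ n ∣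

  module _ (n a0 a1 a2 a3 a4 : ℕ) (small : deviation n a0 a1 a2 a3 a4 ℕ.≤ n) where

    private
      N A0 A1 A2 A3 A4 E0 E12 E23 E34 : ℤ
      N = + n
      A0 = + a0
      A1 = + a1
      A2 = + a2
      A3 = + a3
      A4 = + a4
      E0 = A0 - N
      E12 = A1 + A2 - (N + N)
      E23 = A2 + A3 - (N + N)
      E34 = A3 + A4 - (N + N)

      e0 e12 e23 e34 : ℕ
      e0 = ∣ E0 ∣
      e12 = ∣ E12 ∣
      e23 = ∣ E23 ∣
      e34 = ∣ E34 ∣

      u M B : ℕ
      u = deviation n a0 a1 a2 a3 a4
      M = 5 ℕ.* n
      B = 32 ℕ.* (M ℕ.* M ℕ.* M) ℕ.* u

      u≡ : e0 ℕ.+ e12 ℕ.+ e23 ℕ.+ e34 ≡ u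
      u≡ = cong₂ ℕ._+_ (cong₂ ℕ._+_ (cong₂ ℕ._+_ (∣+m-+n∣≡∣m-n∣ a0 n) (∣+m-+n∣≡∣m-n∣ (a1 ℕ.+ a2) (n ℕ.+ n)))
             (∣+m-+n∣≡∣m-n∣ (a2 ℕ.+ a3) (n ℕ.+ n))) (∣+m-+n∣≡∣m-n∣ (a3 ℕ.+ a4) (n ℕ.+ n))

      part-≤-u : ∀ {x} → x ℕ.≤ e0 ℕ.+ e12 ℕ.+ e23 ℕ.+ e34 → x ℕ.≤ u
      part-≤-u x≤ = ℕ.≤-trans x≤ (ℕ.≤-reflexive u≡)

      e0≤u : e0 ℕ.≤ u
      e0≤u = part-≤-u (ℕ.≤-trans (ℕ.m≤m+n e0 e12) (ℕ.≤-trans (ℕ.m≤m+n _ e23) (ℕ.m≤m+n _ e34)))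
      e12≤u : e12 ℕ.≤ u
      e12≤u = part-≤-u (ℕ.≤-trans (ℕ.m≤n+m e12 e0) (ℕ.≤-trans (ℕ.m≤m+n _ e23) (ℕ.m≤m+n _ e34)))
      e23≤u : e23 ℕ.≤ u
      e23≤u = part-≤-u (ℕ.≤-trans (ℕ.m≤n+m e23 (e0 ℕ.+ e12)) (ℕ.m≤m+n _ e34))
      e34≤u : e34 ℕ.≤ u
      e34≤u = part-≤-u (ℕ.m≤n+m e34 _)
      e0+e12≤u : e0 ℕ.+ e12 ℕ.≤ u
      e0+e12≤u = part-≤-u (ℕ.≤-trans (ℕ.m≤m+n _ e23) (ℕ.m≤m+n _ e34))
      e34+e23≤u : e34 ℕ.+ e23 ℕ.≤ u
      e34+e23≤u = part-≤-u (ℕ.≤-trans (ℕ.m≤n+m _ (e0 ℕ.+ e12)) (ℕ.≤-reflexive (reorder e0 e12 e23 e34)))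
        where
        reorder : ∀ a b c d → a ℕ.+ b ℕ.+ (d ℕ.+ c) ≡ a ℕ.+ b ℕ.+ c ℕ.+ d
        reorder = ℕ-Solver.solve-∀
      e34+e23+e0≤u : e34 ℕ.+ e23 ℕ.+ e0 ℕ.≤ u
      e34+e23+e0≤u = part-≤-u (ℕ.≤-trans (ℕ.m≤m+n _ e12) (ℕ.≤-reflexive (reorder e0 e12 e23 e34)))
        where
        reorder : ∀ a b c d → d ℕ.+ c ℕ.+ a ℕ.+ b ≡ a ℕ.+ b ℕ.+ c ℕ.+ d
        reorder = ℕ-Solver.solve-∀

      D : ℤ
      D = A2 - N

      ≤+dev : ∀ x y → ℕ.∣ x - y ∣ ℕ.≤ n → x ℕ.≤ y ℕ.+ n
      ≤+dev x y dev≤n = ℕ.≤-trans (ℕ.m≤n+∣m-n∣ x y) (ℕ.+-monoʳ-≤ y dev≤n)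

      dev≤n : ∀ {e} → e ℕ.≤ u → e ℕ.≤ n
      dev≤n e≤u = ℕ.≤-trans e≤u small

      a0≤2n : a0 ℕ.≤ n ℕ.+ n
      a0≤2n = ≤+dev a0 n (dev≤n (subst (ℕ._≤ u) (∣+m-+n∣≡∣m-n∣ a0 n) e0≤u))
      a12≤3n : a1 ℕ.+ a2 ℕ.≤ n ℕ.+ n ℕ.+ n
      a12≤3n = ≤+dev (a1 ℕ.+ a2) (n ℕ.+ n) (dev≤n (subst (ℕ._≤ u) (∣+m-+n∣≡∣m-n∣ (a1 ℕ.+ a2) (n ℕ.+ n)) e12≤u))
      a23≤3n : a2 ℕ.+ a3 ℕ.≤ n ℕ.+ n ℕ.+ n
      a23≤3n = ≤+dev (a2 ℕ.+ a3) (n ℕ.+ n) (dev≤n (subst (ℕ._≤ u) (∣+m-+n∣≡∣m-n∣ (a2 ℕ.+ a3) (n ℕ.+ n)) e23≤u))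
      a34≤3n : a3 ℕ.+ a4 ℕ.≤ n ℕ.+ n ℕ.+ n
      a34≤3n = ≤+dev (a3 ℕ.+ a4) (n ℕ.+ n) (dev≤n (subst (ℕ._≤ u) (∣+m-+n∣≡∣m-n∣ (a3 ℕ.+ a4) (n ℕ.+ n)) e34≤u))

      3n≤M : n ℕ.+ n ℕ.+ n ℕ.≤ M
      3n≤M = ℕ.≤-trans (ℕ.m≤m+n _ (n ℕ.+ n)) (ℕ.≤-reflexive (3n+2n≡5n n))
        where
        3n+2n≡5n : ∀ n → n ℕ.+ n ℕ.+ n ℕ.+ (n ℕ.+ n) ≡ 5 ℕ.* n
        3n+2n≡5n = ℕ-Solver.solve-∀
      2n+3n≤M : n ℕ.+ n ℕ.+ (n ℕ.+ n ℕ.+ n) ℕ.≤ M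
      2n+3n≤M = ℕ.≤-reflexive (2n+3n≡5n n)
        where
        2n+3n≡5n : ∀ n → n ℕ.+ n ℕ.+ (n ℕ.+ n ℕ.+ n) ≡ 5 ℕ.* n
        2n+3n≡5n = ℕ-Solver.solve-∀

      a0+a1≤M : a0 ℕ.+ a1 ℕ.≤ M
      a0+a1≤M = ℕ.≤-trans (ℕ.+-mono-≤ a0≤2n (ℕ.≤-trans (ℕ.m≤m+n a1 a2) a12≤3n)) 2n+3n≤M
      a4+a0≤M : a4 ℕ.+ a0 ℕ.≤ M
      a4+a0≤M = ℕ.≤-trans (ℕ.+-mono-≤ (ℕ.≤-trans (ℕ.m≤n+m a4 a3) a34≤3n) a0≤2n) (ℕ.≤-trans (ℕ.≤-reflexive (ℕ.+-comm _ (n ℕ.+ n))) 2n+3n≤M)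
      a0≤M : a0 ℕ.≤ M
      a0≤M = ℕ.≤-trans (ℕ.m≤m+n a0 a1) a0+a1≤M
      a1≤M : a1 ℕ.≤ M
      a1≤M = ℕ.≤-trans (ℕ.m≤m+n a1 a2) (ℕ.≤-trans a12≤3n 3n≤M)
      a2≤M : a2 ℕ.≤ M
      a2≤M = ℕ.≤-trans (ℕ.m≤m+n a2 a3) (ℕ.≤-trans a23≤3n 3n≤M)
      a3≤M : a3 ℕ.≤ M
      a3≤M = ℕ.≤-trans (ℕ.m≤m+n a3 a4) (ℕ.≤-trans a34≤3n 3n≤M)
      a4≤M : a4 ℕ.≤ M
      a4≤M = ℕ.≤-trans (ℕ.m≤n+m a4 a3) (ℕ.≤-trans a34≤3n 3n≤M)
      u≤M : u ℕ.≤ M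
      u≤M = ℕ.≤-trans small (ℕ.m≤m+n n _)

      ∣D∣≤3n : ∣ D ∣ ℕ.≤ n ℕ.+ n ℕ.+ n
      ∣D∣≤3n = ℕ.≤-trans (ℕ.≤-reflexive (∣+m-+n∣≡∣m-n∣ a2 n)) (ℕ.≤-trans (ℕ.∣m-n∣≤m⊔n a2 n)
                 (ℕ.⊔-lub (ℕ.≤-trans (ℕ.m≤m+n a2 a3) a23≤3n) (ℕ.≤-trans (ℕ.m≤m+n n n) (ℕ.m≤m+n _ n))))

      above : ∀ X Y → ∣ X ∣ ℕ.≤ M → ∣ X - Y ∣ ℕ.≤ u → NonNeg (+ B + (quartic X - quartic Y))
      above X Y X≤M X-Y≤u = NonNeg-B+ (quartic X - quartic Y) B (quartic-Lipschitz X Y M u X≤M X-Y≤u u≤M)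
      below : ∀ X Y → ∣ X ∣ ℕ.≤ M → ∣ X - Y ∣ ℕ.≤ u → NonNeg (+ B - (quartic X - quartic Y))
      below X Y X≤M X-Y≤u = NonNeg-B- (quartic X - quartic Y) B (quartic-Lipschitz X Y M u X≤M X-Y≤u u≤M)

      via : ∀ X Y {Z} → X - Y ≡ Z → ∀ {b} → ∣ Z ∣ ℕ.≤ b → b ℕ.≤ u → ∣ X - Y ∣ ℕ.≤ u
      via X Y e Z≤b b≤u = ℕ.≤-trans (ℕ.≤-reflexive (cong ∣_∣ e)) (ℕ.≤-trans Z≤b b≤u)

      pair01 : NonNeg (+ B + (quartic (A0 + A1) - quartic (N + N - D)))
      pair01 = above (A0 + A1) (N + N - D) a0+a1≤M (via (A0 + A1) (N + N - D) (gap01 N A0 A1 A2) (∣i+j∣≤∣i∣+∣j∣ E0 E12) e0+e12≤u)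
      pair12 : NonNeg (+ B + (quartic (A1 + A2) - quartic (N + N)))
      pair12 = above (A1 + A2) (N + N) (ℕ.≤-trans a12≤3n 3n≤M) e12≤u
      pair23 : NonNeg (+ B + (quartic (A2 + A3) - quartic (N + N)))
      pair23 = above (A2 + A3) (N + N) (ℕ.≤-trans a23≤3n 3n≤M) e23≤u
      pair34 : NonNeg (+ B + (quartic (A3 + A4) - quartic (N + N)))
      pair34 = above (A3 + A4) (N + N) (ℕ.≤-trans a34≤3n 3n≤M) e34≤u
      pair40 : NonNeg (+ B + (quartic (A4 + A0) - quartic (N + N + D)))
      pair40 = above (A4 + A0) (N + N + D) a4+a0≤M (via (A4 + A0) (N + N + D) (gap40 N A0 A2 A3 A4)
        (ℕ.≤-trans (∣i+j∣≤∣i∣+∣j∣ (E34 - E23) E0) (ℕ.+-monoˡ-≤ e0 (∣i-j∣≤∣i∣+∣j∣ E34 E23))) e34+e23+e0≤u)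
      class0 : NonNeg (+ B - (quartic A0 - quartic N))
      class0 = below A0 N a0≤M e0≤u
      class1 : NonNeg (+ B - (quartic A1 - quartic (N - D)))
      class1 = below A1 (N - D) a1≤M (via A1 (N - D) (gap1 N A1 A2) ℕ.≤-refl e12≤u)
      class2 : NonNeg (+ B - (quartic A2 - quartic (N + D)))
      class2 = below A2 (N + D) a2≤M (via A2 (N + D) (gap2 N A2) ℕ.≤-refl z≤n)
      class3 : NonNeg (+ B - (quartic A3 - quartic (N - D)))
      class3 = below A3 (N - D) a3≤M (via A3 (N - D) (gap3 N A2 A3) ℕ.≤-refl e23≤u)
      class4 : NonNeg (+ B - (quartic A4 - quartic (N + D)))
      class4 = below A4 (N + D) a4≤M (via A4 (N + D) (gap4 N A2 A3 A4) (∣i-j∣≤∣i∣+∣j∣ E34 E23) e34+e23≤u)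

      d : ℕ
      d = ℕ.∣ a2 - n ∣
      d≡∣D∣ : d ≡ ∣ D ∣
      d≡∣D∣ = sym (∣+m-+n∣≡∣m-n∣ a2 n)
      -- Each bracket is non-negative by quartic-Lipschitz, the last one because |D| ≤ 3n.
      slack : NonNeg (((+ B) + (quartic (A0 + A1) - quartic (N + N - D)))
          + ((+ B) + (quartic (A1 + A2) - quartic (N + N)))
          + ((+ B) + (quartic (A2 + A3) - quartic (N + N)))
          + ((+ B) + (quartic (A3 + A4) - quartic (N + N)))
          + ((+ B) + (quartic (A4 + A0) - quartic (N + N + D)))
          + ((+ B) - (quartic A0 - quartic N))
          + ((+ B) - (quartic A1 - quartic (N - D)))
          + ((+ B) - (quartic A2 - quartic (N + D)))
          + ((+ B) - (quartic A3 - quartic (N - D)))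
          + ((+ B) - (quartic A4 - quartic (N + D)))
          + + 2 * (D * D) * (+ 9 * (N * N) - D * D))
      slack =
        NonNeg-+ (NonNeg-+ (NonNeg-+ (NonNeg-+ (NonNeg-+ (NonNeg-+ (NonNeg-+ (NonNeg-+ (NonNeg-+ (NonNeg-+
          pair01 pair12) pair23) pair34) pair40) class0) class1) class2) class3) class4)
          (NonNeg-* (NonNeg-* (2 , refl) (∣ D ∣ ℕ.* ∣ D ∣ , sym (∣z∣*∣z∣≡z*z D))) |D|≤3N)
        where
        |D|≤3N : NonNeg (+ 9 * (N * N) - D * D)
        |D|≤3N = subst NonNeg (cong₂ _-_ (trans (pos-* 9 (n ℕ.* n)) (cong (+ 9 *_) (pos-* n n))) (∣z∣*∣z∣≡z*z D))
                   (NonNeg-∸ (ℕ.≤-trans (ℕ.*-mono-≤ ∣D∣≤3n ∣D∣≤3n) (ℕ.≤-reflexive (square-3n n))))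
          where
          square-3n : ∀ n → (n ℕ.+ n ℕ.+ n) ℕ.* (n ℕ.+ n ℕ.+ n) ≡ 9 ℕ.* (n ℕ.* n)
          square-3n = ℕ-Solver.solve-∀
      tenB : 40000 ℕ.* (n ℕ.* n ℕ.* n) ℕ.* u ≡ B ℕ.+ B ℕ.+ B ℕ.+ B ℕ.+ B ℕ.+ B ℕ.+ B ℕ.+ B ℕ.+ B ℕ.+ B
      tenB = ten-terms n u
        where
        ten-terms : ∀ n u → 40000 ℕ.* (n ℕ.* n ℕ.* n) ℕ.* u ≡
          let B = 32 ℕ.* ((5 ℕ.* n) ℕ.* (5 ℕ.* n) ℕ.* (5 ℕ.* n)) ℕ.* u in B ℕ.+ B ℕ.+ B ℕ.+ B ℕ.+ B ℕ.+ B ℕ.+ B ℕ.+ B ℕ.+ B ℕ.+ B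
        ten-terms = ℕ-Solver.solve-∀
      pairs-cast : + ((a0 ℕ.+ a1) ⁴ ℕ.+ (a1 ℕ.+ a2) ⁴ ℕ.+ (a2 ℕ.+ a3) ⁴ ℕ.+ (a3 ℕ.+ a4) ⁴ ℕ.+ (a4 ℕ.+ a0) ⁴
                      ℕ.+ 40000 ℕ.* (n ℕ.* n ℕ.* n) ℕ.* u)
        ≡ (quartic (A0 + A1) + quartic (A1 + A2) + quartic (A2 + A3) + quartic (A3 + A4) + quartic (A4 + A0))
          + (+ B + + B + + B + + B + + B + + B + + B + + B + + B + + B)
      pairs-cast = cong₂ _+_
        (cong₂ _+_ (cong₂ _+_ (cong₂ _+_ (cong₂ _+_ (+-quartic (a0 ℕ.+ a1)) (+-quartic (a1 ℕ.+ a2)))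
          (+-quartic (a2 ℕ.+ a3))) (+-quartic (a3 ℕ.+ a4))) (+-quartic (a4 ℕ.+ a0)))
        (cong +_ tenB)
      classes-cast : + (a0 ⁴ ℕ.+ a1 ⁴ ℕ.+ a2 ⁴ ℕ.+ a3 ⁴ ℕ.+ a4 ⁴ ℕ.+ 75 ℕ.* n ⁴ ℕ.+ 6 ℕ.* (n ℕ.* n) ℕ.* (d ℕ.* d))
        ≡ quartic A0 + quartic A1 + quartic A2 + quartic A3 + quartic A4 + + 75 * quartic N + + 6 * (N * N) * (D * D)
      classes-cast = cong₂ _+_
        (cong₂ _+_ (cong₂ _+_ (cong₂ _+_ (cong₂ _+_ (cong₂ _+_ (+-quartic a0) (+-quartic a1)) (+-quartic a2)) (+-quartic a3)) (+-quartic a4))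
          (trans (pos-* 75 (n ⁴)) (cong (+ 75 *_) (+-quartic n))))
        (trans (pos-* (6 ℕ.* (n ℕ.* n)) (d ℕ.* d))
          (cong₂ _*_ (trans (pos-* 6 (n ℕ.* n)) (cong (+ 6 *_) (pos-* n n)))
                     (trans (cong (λ z → + (z ℕ.* z)) d≡∣D∣) (∣z∣*∣z∣≡z*z D))))
      balance : + ((a0 ℕ.+ a1) ⁴ ℕ.+ (a1 ℕ.+ a2) ⁴ ℕ.+ (a2 ℕ.+ a3) ⁴ ℕ.+ (a3 ℕ.+ a4) ⁴ ℕ.+ (a4 ℕ.+ a0) ⁴
                   ℕ.+ 40000 ℕ.* (n ℕ.* n ℕ.* n) ℕ.* u)
              ≡ + (a0 ⁴ ℕ.+ a1 ⁴ ℕ.+ a2 ⁴ ℕ.+ a3 ⁴ ℕ.+ a4 ⁴ ℕ.+ 75 ℕ.* n ⁴ ℕ.+ 6 ℕ.* (n ℕ.* n) ℕ.* (d ℕ.* d) ℕ.+ proj₁ slack)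
      balance = trans pairs-cast (trans (certificate N A0 A1 A2 A3 A4 (+ B)) (cong₂ _+_ (sym classes-cast) (proj₂ slack)))

    quartic-stability :
      let d = ℕ.∣ a2 - n ∣ in
      a0 ⁴ ℕ.+ a1 ⁴ ℕ.+ a2 ⁴ ℕ.+ a3 ⁴ ℕ.+ a4 ⁴ ℕ.+ 75 ℕ.* n ⁴ ℕ.+ 6 ℕ.* (n ℕ.* n) ℕ.* (d ℕ.* d)
      ℕ.≤ (a0 ℕ.+ a1) ⁴ ℕ.+ (a1 ℕ.+ a2) ⁴ ℕ.+ (a2 ℕ.+ a3) ⁴ ℕ.+ (a3 ℕ.+ a4) ⁴ ℕ.+ (a4 ℕ.+ a0) ⁴
          ℕ.+ 40000 ℕ.* (n ℕ.* n ℕ.* n) ℕ.* deviation n a0 a1 a2 a3 a4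
    quartic-stability = ℕ.≤-trans (ℕ.m≤m+n _ (proj₁ slack)) (ℕ.≤-reflexive (sym (+-injective balance)))

module Estimates where

  open import Defs using (_⊕_)
  open Counting using (sum-map-+; sum-map-mono; sum-*ˡ)
  open Labels using (Σ₅)
  open Binomial
  open QuarticStability using (deviation; quartic-stability)
  open import Data.Nat
  open import Data.Nat.Properties
  open import Algebra.Properties.CommutativeSemigroup *-commutativeSemigroup using (x∙yz≈y∙xz)
  open import Data.Nat.Combinatorics using (_C_)
  open import Data.Fin using (Fin; zero; suc)
  open import Data.List.Base using (List; allFin)
  open import Relation.Binary.PropositionalEquality
  open import Relation.Nullary using (yes; no)
  open import Data.Empty using (⊥-elim)
  open import Data.Unit using (tt)
  import Data.Nat.Tactic.RingSolver as ℕ-Solver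

  private
    sum-cubes-≤ : ∀ {a b n} → a ≤ n → b ≤ n → (a + b) ³ ≤ 8 * n ³
    sum-cubes-≤ {a} {b} {n} a≤n b≤n = ≤-trans (*-mono-≤ (*-mono-≤ a+b≤2n a+b≤2n) a+b≤2n) (≤-reflexive (cube-2n n))
      where
      a+b≤2n : a + b ≤ n + n
      a+b≤2n = +-mono-≤ a≤n b≤n
      cube-2n : ∀ n → (n + n) * (n + n) * (n + n) ≡ 8 * (n * n * n)
      cube-2n = ℕ-Solver.solve-∀

  pair-quartics-≤ : ∀ (n t h : ℕ) (s : Fin 5 → ℕ) → (∀ i → s i ≤ n) →
    Σ₅ (λ i → (s i + s (i ⊕ 1)) C 4) ≤ t + 6 * n ³ * h + Σ₅ (λ i → s i C 4) →
    Σ₅ (λ i → (s i + s (i ⊕ 1)) ⁴) ≤ 24 * t + 144 * n ³ * h + Σ₅ (λ i → s i ⁴) + 240 * n ³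
  pair-quartics-≤ n t h s s≤n cliques = begin
    Σ₅ (λ i → pair i ⁴)
      ≤⟨ sum-map-mono (λ i → m⁴≤24*[mC4]+6m³ (pair i)) F ⟩
    Σ₅ (λ i → 24 * (pair i C 4) + 6 * pair i ³)
      ≡⟨ sum-map-+ (λ i → 24 * (pair i C 4)) (λ i → 6 * pair i ³) F ⟩
    Σ₅ (λ i → 24 * (pair i C 4)) + Σ₅ (λ i → 6 * pair i ³)
      ≡⟨ cong₂ _+_ (sum-*ˡ 24 (λ i → pair i C 4) F) (sum-*ˡ 6 (λ i → pair i ³) F) ⟩
    24 * Σ₅ (λ i → pair i C 4) + 6 * Σ₅ (λ i → pair i ³)
      ≤⟨ +-mono-≤ (*-monoʳ-≤ 24 cliques) (*-monoʳ-≤ 6 (sum-map-mono (λ i → sum-cubes-≤ (s≤n i) (s≤n (i ⊕ 1))) F)) ⟩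
    24 * (t + 6 * n ³ * h + Σ₅ (λ i → s i C 4)) + 6 * (5 * (8 * n ³))
      ≡⟨ expand t (n ³) h (Σ₅ (λ i → s i C 4)) ⟩
    24 * t + 144 * n ³ * h + 24 * Σ₅ (λ i → s i C 4) + 240 * n ³
      ≤⟨ +-monoˡ-≤ (240 * n ³) (+-monoʳ-≤ (24 * t + 144 * n ³ * h) singles) ⟩
    24 * t + 144 * n ³ * h + Σ₅ (λ i → s i ⁴) + 240 * n ³ ∎
    where
    open ≤-Reasoning
    F : List (Fin 5)
    F = allFin 5
    pair : Fin 5 → ℕ
    pair i = s i + s (i ⊕ 1)
    expand : ∀ t c h X → 24 * (t + 6 * c * h + X) + 6 * (5 * (8 * c)) ≡ 24 * t + 144 * c * h + 24 * X + 240 * c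
    expand = ℕ-Solver.solve-∀
    singles : 24 * Σ₅ (λ i → s i C 4) ≤ Σ₅ (λ i → s i ⁴)
    singles = ≤-trans (≤-reflexive (sym (sum-*ˡ 24 (λ i → s i C 4) F))) (sum-map-mono (λ i → 24*[mC4]≤m⁴ (s i)) F)

  scaled-stability : ∀ (n : ℕ) (s : Fin 5 → ℕ) →
    let u = deviation n (5 * s zero) (5 * s (suc zero)) (5 * s (suc (suc zero))) (5 * s (suc (suc (suc zero))))
                        (5 * s (suc (suc (suc (suc zero)))))
        d = ∣ 5 * s (suc (suc zero)) - n ∣ in
    u ≤ n →
    625 * Σ₅ (λ i → s i ⁴) + 75 * n ⁴ + 6 * (n * n) * (d * d) ≤ 625 * Σ₅ (λ i → (s i + s (i ⊕ 1)) ⁴) + 40000 * n ³ * u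
  scaled-stability n s u≤n =
    subst₂ (λ a b → a + 75 * n ⁴ + 6 * (n * n) * (∣ 5 * s2 - n ∣ * ∣ 5 * s2 - n ∣) ≤ b + 40000 * n ³ * deviation n (5 * s0) (5 * s1) (5 * s2) (5 * s3) (5 * s4))
      (trans (cong₂ _+_ (cong₂ _+_ (cong₂ _+_ (cong₂ _+_ (5⁴ s0) (5⁴ s1)) (5⁴ s2)) (5⁴ s3)) (5⁴ s4))
             (trans (reassociate (625 * s0 ⁴) (625 * s1 ⁴) (625 * s2 ⁴) (625 * s3 ⁴) (625 * s4 ⁴)) (sum-*ˡ 625 (λ i → s i ⁴) (allFin 5))))
      (trans (cong₂ _+_ (cong₂ _+_ (cong₂ _+_ (cong₂ _+_ (5⁴-pair s0 s1) (5⁴-pair s1 s2)) (5⁴-pair s2 s3)) (5⁴-pair s3 s4)) (5⁴-pair s4 s0))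
             (trans (reassociate (625 * (s0 + s1) ⁴) (625 * (s1 + s2) ⁴) (625 * (s2 + s3) ⁴) (625 * (s3 + s4) ⁴) (625 * (s4 + s0) ⁴))
                    (sum-*ˡ 625 (λ i → (s i + s (i ⊕ 1)) ⁴) (allFin 5))))
      (quartic-stability n (5 * s0) (5 * s1) (5 * s2) (5 * s3) (5 * s4) u≤n)
    where
    s0 s1 s2 s3 s4 : ℕ
    s0 = s zero
    s1 = s (suc zero)
    s2 = s (suc (suc zero))
    s3 = s (suc (suc (suc zero)))
    s4 = s (suc (suc (suc (suc zero))))
    5⁴ : ∀ a → (5 * a) ⁴ ≡ 625 * a ⁴
    5⁴ a = expand a
      where
      expand : ∀ a → ((5 * a) * (5 * a)) * ((5 * a) * (5 * a)) ≡ 625 * ((a * a) * (a * a))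
      expand = ℕ-Solver.solve-∀
    5⁴-pair : ∀ a b → (5 * a + 5 * b) ⁴ ≡ 625 * (a + b) ⁴
    5⁴-pair a b = trans (cong _⁴ (sym (*-distribˡ-+ 5 a b))) (5⁴ (a + b))
    reassociate : ∀ x0 x1 x2 x3 x4 → x0 + x1 + x2 + x3 + x4 ≡ x0 + (x1 + (x2 + (x3 + (x4 + 0))))
    reassociate = ℕ-Solver.solve-∀

  ≤+∣-∣ : ∀ x y e z → ∣ x - y ∣ * e ≤ z → x * e ≤ y * e + z
  ≤+∣-∣ x y e z dev≤z = begin
    x * e                  ≤⟨ *-monoˡ-≤ e (m≤n+∣m-n∣ x y) ⟩
    (y + ∣ x - y ∣) * e    ≡⟨ *-distribʳ-+ e y ∣ x - y ∣ ⟩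
    y * e + ∣ x - y ∣ * e  ≤⟨ +-monoʳ-≤ (y * e) dev≤z ⟩
    y * e + z              ∎
    where open ≤-Reasoning

  module _ (n t h e : ℕ) (s : Fin 5 → ℕ) (s≤n : ∀ i → s i ≤ n)
    (cliques : Σ₅ (λ i → (s i + s (i ⊕ 1)) C 4) ≤ t + 6 * n ³ * h + Σ₅ (λ i → s i C 4))
    (t-close : ∣ 25 * t - 3 * (n C 4) ∣ * e ≤ 25 * (n C 4))
    (h-small : h * e ≤ n)
    where

    private
      u d P Q : ℕ
      u = deviation n (5 * s zero) (5 * s (suc zero)) (5 * s (suc (suc zero))) (5 * s (suc (suc (suc zero))))
                      (5 * s (suc (suc (suc (suc zero)))))
      d = ∣ 5 * s (suc (suc zero)) - n ∣
      P = Σ₅ (λ i → (s i + s (i ⊕ 1)) ⁴)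
      Q = Σ₅ (λ i → s i ⁴)

      open ≤-Reasoning

      c4 : ℕ
      c4 = n C 4

      n³*n≡n⁴ : n ³ * n ≡ n ⁴
      n³*n≡n⁴ = cube-times n
        where
        cube-times : ∀ n → n * n * n * n ≡ (n * n) * (n * n)
        cube-times = ℕ-Solver.solve-∀

      stability-with-clique-count : u ≤ n →
        6 * (n * n) * (d * d) + 75 * n ⁴ ≤ 15000 * t + 90000 * n ³ * h + 150000 * n ³ + 40000 * n ³ * u
      stability-with-clique-count u≤n = +-cancelʳ-≤ (625 * Q) (6 * (n * n) * (d * d) + 75 * n ⁴)
                    (15000 * t + 90000 * n ³ * h + 150000 * n ³ + 40000 * n ³ * u) (begin
        6 * (n * n) * (d * d) + 75 * n ⁴ + 625 * Q
          ≡⟨ rotate (6 * (n * n) * (d * d)) (75 * n ⁴) (625 * Q) ⟩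
        625 * Q + 75 * n ⁴ + 6 * (n * n) * (d * d)
          ≤⟨ scaled-stability n s u≤n ⟩
        625 * P + 40000 * n ³ * u
          ≤⟨ +-monoˡ-≤ (40000 * n ³ * u) (*-monoʳ-≤ 625 (pair-quartics-≤ n t h s s≤n cliques)) ⟩
        625 * (24 * t + 144 * n ³ * h + Q + 240 * n ³) + 40000 * n ³ * u
          ≡⟨ spread t (n ³) h Q u ⟩
        15000 * t + 90000 * n ³ * h + 150000 * n ³ + 40000 * n ³ * u + 625 * Q ∎)
        where
        rotate : ∀ a b c → a + b + c ≡ c + b + a
        rotate = ℕ-Solver.solve-∀
        spread : ∀ t c h Q u → 625 * (24 * t + 144 * c * h + Q + 240 * c) + 40000 * c * u
                             ≡ 15000 * t + 90000 * c * h + 150000 * c + 40000 * c * u + 625 * Q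
        spread = ℕ-Solver.solve-∀

      t4-contribution : 600 * (25 * t * e) ≤ 75 * e * n ⁴ + 625 * n ⁴
      t4-contribution = begin
        600 * (25 * t * e)                        ≤⟨ *-monoʳ-≤ 600 (≤+∣-∣ (25 * t) (3 * c4) e (25 * c4) t-close) ⟩
        600 * (3 * c4 * e + 25 * c4)              ≡⟨ regroup e c4 ⟩
        75 * e * (24 * c4) + 625 * (24 * c4)      ≤⟨ +-mono-≤ (*-monoʳ-≤ (75 * e) (24*[mC4]≤m⁴ n)) (*-monoʳ-≤ 625 (24*[mC4]≤m⁴ n)) ⟩
        75 * e * n ⁴ + 625 * n ⁴                  ∎
        where
        regroup : ∀ e C → 600 * (3 * C * e + 25 * C) ≡ 75 * e * (24 * C) + 625 * (24 * C)
        regroup = ℕ-Solver.solve-∀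

      h-contribution : 90000 * n ³ * (h * e) ≤ 90000 * n ⁴
      h-contribution = ≤-trans (*-monoʳ-≤ (90000 * n ³) h-small)
                               (≤-reflexive (trans (*-assoc 90000 (n ³) n) (cong (90000 *_) n³*n≡n⁴)))

      deviation-contribution : u * e ≤ 20 * n → 40000 * n ³ * (u * e) ≤ 800000 * n ⁴
      deviation-contribution ue≤20n = begin
        40000 * n ³ * (u * e)         ≤⟨ *-monoʳ-≤ (40000 * n ³) ue≤20n ⟩
        40000 * n ³ * (20 * n)        ≡⟨ *-assoc 40000 (n ³) (20 * n) ⟩
        40000 * (n ³ * (20 * n))      ≡⟨ cong (40000 *_) (x∙yz≈y∙xz (n ³) 20 n) ⟩
        40000 * (20 * (n ³ * n))      ≡⟨ *-assoc 40000 20 (n ³ * n) ⟨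
        800000 * (n ³ * n)            ≡⟨ cong (800000 *_) n³*n≡n⁴ ⟩
        800000 * n ⁴                  ∎

    middle-class-bound : u ≤ n → u * e ≤ 20 * n →
      6 * e * (n * n) * (d * d) ≤ 890625 * n ⁴ + 150000 * e * n ³
    middle-class-bound u≤n ue≤20n =
      +-cancelʳ-≤ (75 * e * n ⁴) (6 * e * (n * n) * (d * d)) (890625 * n ⁴ + 150000 * e * n ³) (begin
      6 * e * (n * n) * (d * d) + 75 * e * n ⁴
        ≡⟨ factor-e e (n * n) (d * d) (n ⁴) ⟩
      e * (6 * (n * n) * (d * d) + 75 * n ⁴)
        ≤⟨ *-monoʳ-≤ e (stability-with-clique-count u≤n) ⟩
      e * (15000 * t + 90000 * n ³ * h + 150000 * n ³ + 40000 * n ³ * u)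
        ≡⟨ distribute-e e t (n ³) h u ⟩
      600 * (25 * t * e) + 90000 * n ³ * (h * e) + 150000 * e * n ³ + 40000 * n ³ * (u * e)
        ≤⟨ +-mono-≤ (+-monoˡ-≤ (150000 * e * n ³) (+-mono-≤ t4-contribution h-contribution))
                    (deviation-contribution ue≤20n) ⟩
      75 * e * n ⁴ + 625 * n ⁴ + 90000 * n ⁴ + 150000 * e * n ³ + 800000 * n ⁴
        ≡⟨ collect e (n ⁴) (n ³) ⟩
      890625 * n ⁴ + 150000 * e * n ³ + 75 * e * n ⁴ ∎)
      where
      factor-e : ∀ e a b q → 6 * e * a * b + 75 * e * q ≡ e * (6 * a * b + 75 * q)
      factor-e = ℕ-Solver.solve-∀
      distribute-e : ∀ e t c h u → e * (15000 * t + 90000 * c * h + 150000 * c + 40000 * c * u)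
                                  ≡ 600 * (25 * t * e) + 90000 * c * (h * e) + 150000 * e * c + 40000 * c * (u * e)
      distribute-e = ℕ-Solver.solve-∀
      collect : ∀ e q c → 75 * e * q + 625 * q + 90000 * q + 150000 * e * c + 800000 * q
                          ≡ 890625 * q + 150000 * e * c + 75 * e * q
      collect = ℕ-Solver.solve-∀

  private
    square-≤⇒≤ : ∀ x n → x * x ≤ n * n → x ≤ n
    square-≤⇒≤ x n x²≤n² with x ≤? n
    ... | yes x≤n = x≤n
    ... | no  x≰n = ⊥-elim (<⇒≱ (*-mono-< (≰⇒> x≰n) (≰⇒> x≰n)) x²≤n²)

  deviation-≤ : ∀ c₁ c₂ w n d → 1 ≤ c₁ → 1 ≤ w → c₂ * (w * w) ≤ n → 1 ≤ n →
    6 * (c₁ * (w * w)) * (n * n) * (d * d) ≤ c₁ * n ⁴ + c₂ * (c₁ * (w * w)) * n ³ →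
    d * w ≤ n
  deviation-≤ c₁ c₂ w n d 1≤c₁ 1≤w c₂w²≤n 1≤n bound =
    square-≤⇒≤ (d * w) n (*-cancelˡ-≤ 2 (≤-trans (*-monoˡ-≤ ((d * w) * (d * w)) {2} {6} (s≤s (s≤s z≤n))) six))
    where
    open ≤-Reasoning
    e = c₁ * (w * w)
    en²-positive : 0 < e * (n * n)
    en²-positive = *-mono-≤ {1} {e} (*-mono-≤ {1} {c₁} 1≤c₁ (*-mono-≤ {1} {w} 1≤w 1≤w)) (*-mono-≤ {1} {n} 1≤n 1≤n)
    six : 6 * ((d * w) * (d * w)) ≤ 2 * (n * n)
    six = *-cancelʳ-≤ (6 * ((d * w) * (d * w))) (2 * (n * n)) (e * (n * n)) {{>-nonZero en²-positive}} (begin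
      6 * ((d * w) * (d * w)) * (e * (n * n))           ≡⟨ shuffle₁ c₁ w n d ⟩
      6 * e * (n * n) * (d * d) * (w * w)               ≤⟨ *-monoˡ-≤ (w * w) bound ⟩
      (c₁ * n ⁴ + c₂ * e * n ³) * (w * w)               ≡⟨ shuffle₂ c₁ c₂ w n ⟩
      e * n ⁴ + (c₂ * (w * w)) * (e * n ³)              ≤⟨ +-monoʳ-≤ (e * n ⁴) (*-monoˡ-≤ (e * n ³) c₂w²≤n) ⟩
      e * n ⁴ + n * (e * n ³)                           ≡⟨ shuffle₃ e n ⟩
      2 * (n * n) * (e * (n * n))                       ∎)
      where
      shuffle₁ : ∀ c₁ w n d → 6 * ((d * w) * (d * w)) * ((c₁ * (w * w)) * (n * n)) ≡ 6 * (c₁ * (w * w)) * (n * n) * (d * d) * (w * w)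
      shuffle₁ = ℕ-Solver.solve-∀
      shuffle₂ : ∀ c₁ c₂ w n → (c₁ * ((n * n) * (n * n)) + c₂ * (c₁ * (w * w)) * (n * n * n)) * (w * w)
                             ≡ (c₁ * (w * w)) * ((n * n) * (n * n)) + (c₂ * (w * w)) * ((c₁ * (w * w)) * (n * n * n))
      shuffle₂ = ℕ-Solver.solve-∀
      shuffle₃ : ∀ e n → e * ((n * n) * (n * n)) + n * (e * (n * n * n)) ≡ 2 * (n * n) * (e * (n * n))
      shuffle₃ = ℕ-Solver.solve-∀

  ∣a-n∣≤∣a+b-2n∣+∣b-n∣ : ∀ a b n → ∣ a - n ∣ ≤ ∣ a + b - n + n ∣ + ∣ b - n ∣
  ∣a-n∣≤∣a+b-2n∣+∣b-n∣ a b n = begin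
    ∣ a - n ∣                               ≡⟨ ∣m+n-m+o∣≡∣n-o∣ b a n ⟨
    ∣ b + a - b + n ∣                       ≡⟨ cong₂ ∣_-_∣ (+-comm b a) (+-comm b n) ⟩
    ∣ a + b - n + b ∣                       ≤⟨ ∣-∣-triangle (a + b) (n + n) (n + b) ⟩
    ∣ a + b - n + n ∣ + ∣ n + n - n + b ∣   ≡⟨ cong (∣ a + b - n + n ∣ +_) (trans (∣m+n-m+o∣≡∣n-o∣ n n b) (∣-∣-comm n b)) ⟩
    ∣ a + b - n + n ∣ + ∣ b - n ∣           ∎
    where open ≤-Reasoning

  -- 50 (h + h) = 100 h ≤ n, while 50 s ≥ 10 n - 10 x ≥ 7 n.
  class-exceeds-2h : ∀ s x h n → x * 10 ≤ n + n + n → n ≤ 5 * s + x → h * 100 ≤ n → 1 ≤ n → h + h < s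
  class-exceeds-2h s x h n 10x≤3n n≤5s+x 100h≤n 1≤n = *-cancelˡ-< 50 (h + h) s (begin-strict
    50 * (h + h)                ≡⟨ double h ⟩
    h * 100                     ≤⟨ 100h≤n ⟩
    n                           <⟨ n<7n 1≤n ⟩
    7 * n                       ≤⟨ +-cancelʳ-≤ (n + n + n) (7 * n) (50 * s) (begin
      7 * n + (n + n + n)         ≡⟨ ten n ⟩
      10 * n                      ≤⟨ *-monoʳ-≤ 10 n≤5s+x ⟩
      10 * (5 * s + x)            ≡⟨ spread s x ⟩
      50 * s + x * 10             ≤⟨ +-monoʳ-≤ (50 * s) 10x≤3n ⟩
      50 * s + (n + n + n)        ∎) ⟩
    50 * s                      ∎)
    where
    open ≤-Reasoning
    double : ∀ h → 50 * (h + h) ≡ h * 100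
    double = ℕ-Solver.solve-∀
    n<7n : ∀ {n} → 1 ≤ n → n < 7 * n
    n<7n {n} 1≤n = subst (_< 7 * n) (+-identityʳ n) (+-monoʳ-< n (≤-trans 1≤n (m≤m+n n (5 * n))))
    ten : ∀ n → 7 * n + (n + n + n) ≡ 10 * n
    ten = ℕ-Solver.solve-∀
    spread : ∀ s x → 10 * (5 * s + x) ≡ 50 * s + x * 10
    spread = ℕ-Solver.solve-∀

  -- e = c₁ w² with w = K + 1 and the constant c₁ of middle-class-bound, as deviation-≤ requires.
  precision : ℕ → ℕ
  precision K = 890625 * (suc K * suc K)

  record Precise (e n t h : ℕ) (s : Fin 5 → ℕ) : Set where
    field
      t-close : ∣ 25 * t - 3 * (n C 4) ∣ * e ≤ 25 * (n C 4)
      class0  : ∣ 5 * s zero - 1 * n ∣ * e ≤ 5 * n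
      pair12  : ∣ 5 * (s (suc zero) + s (suc (suc zero))) - 2 * n ∣ * e ≤ 5 * n
      pair23  : ∣ 5 * (s (suc (suc zero)) + s (suc (suc (suc zero)))) - 2 * n ∣ * e ≤ 5 * n
      pair34  : ∣ 5 * (s (suc (suc (suc zero))) + s (suc (suc (suc (suc zero))))) - 2 * n ∣ * e ≤ 5 * n
      h-small : ∣ 1 * h - 0 * n ∣ * e ≤ 1 * n

  module _ {K n t h : ℕ} {s : Fin 5 → ℕ} (s≤n : ∀ i → s i ≤ n)
    (cliques : Σ₅ (λ i → (s i + s (i ⊕ 1)) C 4) ≤ t + 6 * n ³ * h + Σ₅ (λ i → s i C 4))
    (precise : Precise (precision K) n t h s) (n-large : 150000 * (suc K * suc K) ≤ n) where

    open Precise precise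

    private
      w e : ℕ
      w = suc K
      e = precision K
      s0 s1 s2 s3 s4 : ℕ
      s0 = s zero
      s1 = s (suc zero)
      s2 = s (suc (suc zero))
      s3 = s (suc (suc (suc zero)))
      s4 = s (suc (suc (suc (suc zero))))

      open ≤-Reasoning

      1≤n : 1 ≤ n
      1≤n = ≤-trans (s≤s z≤n) (≤-trans (m≤m*n 150000 (w * w)) n-large)

      w≤e/5 : 5 * w ≤ e
      w≤e/5 = *-mono-≤ {5} {890625} {w} {w * w} (≤ᵇ⇒≤ 5 890625 tt) (m≤m*n w w)

      rescale : ∀ x → x * e ≤ 5 * n → x * w ≤ n
      rescale x xe≤5n = *-cancelˡ-≤ 5 (begin
        5 * (x * w)   ≡⟨ x∙yz≈y∙xz 5 x w ⟩
        x * (5 * w)   ≤⟨ *-monoʳ-≤ x w≤e/5 ⟩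
        x * e         ≤⟨ xe≤5n ⟩
        5 * n         ∎)

      shrink : ∀ x k .{{_ : NonZero k}} → x * e ≤ k * n → k ≤ e → x ≤ n
      shrink x k xe≤kn k≤e = *-cancelˡ-≤ k (begin
        k * x    ≡⟨ *-comm k x ⟩
        x * k    ≤⟨ *-monoʳ-≤ x k≤e ⟩
        x * e    ≤⟨ xe≤kn ⟩
        k * n    ∎)

      v0 v12 v23 v34 d : ℕ
      v0 = ∣ 5 * s0 - n ∣
      v12 = ∣ 5 * s1 + 5 * s2 - n + n ∣
      v23 = ∣ 5 * s2 + 5 * s3 - n + n ∣
      v34 = ∣ 5 * s3 + 5 * s4 - n + n ∣
      d = ∣ 5 * s2 - n ∣

      pair-form : ∀ a b → ∣ 5 * (a + b) - 2 * n ∣ ≡ ∣ 5 * a + 5 * b - n + n ∣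
      pair-form a b = cong₂ ∣_-_∣ (*-distribˡ-+ 5 a b) (cong (n +_) (+-identityʳ n))

      class-form : ∀ a → ∣ 5 * a - 1 * n ∣ ≡ ∣ 5 * a - n ∣
      class-form a = cong (∣ 5 * a -_∣) (*-identityˡ n)

      v0e : v0 * e ≤ 5 * n
      v0e = subst (λ z → z * e ≤ 5 * n) (class-form s0) class0
      v12e : v12 * e ≤ 5 * n
      v12e = subst (λ z → z * e ≤ 5 * n) (pair-form s1 s2) pair12
      v23e : v23 * e ≤ 5 * n
      v23e = subst (λ z → z * e ≤ 5 * n) (pair-form s2 s3) pair23
      v34e : v34 * e ≤ 5 * n
      v34e = subst (λ z → z * e ≤ 5 * n) (pair-form s3 s4) pair34

      he≤n : h * e ≤ n
      he≤n = subst₂ (λ a b → a * e ≤ b) (trans (∣-∣-identityʳ (h + 0)) (+-identityʳ h)) (+-identityʳ n) h-small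

      ue≤20n : (v0 + v12 + v23 + v34) * e ≤ 20 * n
      ue≤20n = begin
        (v0 + v12 + v23 + v34) * e             ≡⟨ distribute v0 v12 v23 v34 e ⟩
        v0 * e + v12 * e + v23 * e + v34 * e   ≤⟨ +-mono-≤ (+-mono-≤ (+-mono-≤ v0e v12e) v23e) v34e ⟩
        5 * n + 5 * n + 5 * n + 5 * n          ≡⟨ twenty n ⟩
        20 * n                                 ∎
        where
        distribute : ∀ a b c d e → (a + b + c + d) * e ≡ a * e + b * e + c * e + d * e
        distribute = ℕ-Solver.solve-∀
        twenty : ∀ n → 5 * n + 5 * n + 5 * n + 5 * n ≡ 20 * n
        twenty = ℕ-Solver.solve-∀

      20≤e : 20 ≤ e
      20≤e = ≤-trans (≤ᵇ⇒≤ 20 890625 tt) (m≤m*n 890625 (w * w))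

      dw≤n : d * w ≤ n
      dw≤n = deviation-≤ 890625 150000 w n d (s≤s z≤n) (s≤s z≤n) n-large 1≤n
        (middle-class-bound n t h e s s≤n cliques t-close he≤n (shrink _ 20 ue≤20n 20≤e) ue≤20n)

      spread-≤ : ∀ {x a b c} → x ≤ a + b + c → a * w ≤ n → b * w ≤ n → c * w ≤ n → x * w ≤ n + n + n
      spread-≤ {x} {a} {b} {c} x≤ aw bw cw = begin
        x * w                       ≤⟨ *-monoˡ-≤ w x≤ ⟩
        (a + b + c) * w             ≡⟨ trans (*-distribʳ-+ w (a + b) c) (cong (_+ c * w) (*-distribʳ-+ w a b)) ⟩
        a * w + b * w + c * w       ≤⟨ +-mono-≤ (+-mono-≤ aw bw) cw ⟩
        n + n + n                   ∎

      class-deviation-≤3n : ∀ i → ∣ 5 * s i - n ∣ * w ≤ n + n + n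
      class-deviation-≤3n zero = spread-≤ {a = v0} {0} {0} (≤-reflexive (sym (trans (+-identityʳ _) (+-identityʳ _))))
        (rescale v0 v0e) z≤n z≤n
      class-deviation-≤3n (suc zero) = spread-≤ {a = v12} {d} {0} (≤-trans (∣a-n∣≤∣a+b-2n∣+∣b-n∣ (5 * s1) (5 * s2) n) (≤-reflexive (sym (+-identityʳ _))))
        (rescale v12 v12e) dw≤n z≤n
      class-deviation-≤3n (suc (suc zero)) = spread-≤ {a = d} {0} {0} (≤-reflexive (sym (trans (+-identityʳ _) (+-identityʳ _)))) dw≤n z≤n z≤n
      class-deviation-≤3n (suc (suc (suc zero))) = spread-≤ {a = v23} {d} {0}
        (≤-trans (∣a-n∣≤∣a+b-2n∣+∣b-n∣ (5 * s3) (5 * s2) n)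
                 (≤-reflexive (trans (cong (λ z → ∣ z - n + n ∣ + d) (+-comm (5 * s3) (5 * s2))) (sym (+-identityʳ _)))))
        (rescale v23 v23e) dw≤n z≤n
      class-deviation-≤3n (suc (suc (suc (suc zero)))) = spread-≤ {a = v34} {v23} {d}
        (≤-trans (∣a-n∣≤∣a+b-2n∣+∣b-n∣ (5 * s4) (5 * s3) n)
                 (≤-trans (+-mono-≤ (≤-reflexive (cong (λ z → ∣ z - n + n ∣) (+-comm (5 * s4) (5 * s3))))
                                    (≤-trans (∣a-n∣≤∣a+b-2n∣+∣b-n∣ (5 * s3) (5 * s2) n)
                                             (≤-reflexive (cong (λ z → ∣ z - n + n ∣ + d) (+-comm (5 * s3) (5 * s2))))))
                          (≤-reflexive (sym (+-assoc v34 v23 d)))))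
        (rescale v34 v34e) (rescale v23 v23e) dw≤n

    class-deviation : ∀ i → ∣ 5 * s i - 1 * n ∣ * suc K ≤ 5 * n
    class-deviation i = begin
      ∣ 5 * s i - 1 * n ∣ * w   ≡⟨ cong (_* w) (class-form (s i)) ⟩
      ∣ 5 * s i - n ∣ * w       ≤⟨ class-deviation-≤3n i ⟩
      n + n + n                 ≤⟨ m≤m+n (n + n + n) (n + n) ⟩
      n + n + n + (n + n)       ≡⟨ five n ⟩
      5 * n                     ∎
      where
      five : ∀ n → n + n + n + (n + n) ≡ 5 * n
      five = ℕ-Solver.solve-∀

    classes-exceed-2h : 10 ≤ suc K → ∀ i → h + h < s i
    classes-exceed-2h 10≤w i = class-exceeds-2h (s i) ∣ 5 * s i - n ∣ h n
      (≤-trans (*-monoʳ-≤ ∣ 5 * s i - n ∣ 10≤w) (class-deviation-≤3n i)) (m≤n+∣n-m∣ n (5 * s i)) 100h≤n 1≤n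
      where
      100h≤n : h * 100 ≤ n
      100h≤n = ≤-trans (*-monoʳ-≤ h (≤-trans (≤ᵇ⇒≤ 100 890625 tt) (m≤m*n 890625 (w * w)))) he≤n

open import Defs
open Counting using (count≤length)
open Quadruples using (length-allFin)
open PairUnions using (consecutive-pairs-bound)
open Cliques using (consecutive-union-clique)
open Estimates using (precision; Precise; class-deviation; classes-exceed-2h)
open import Data.Nat using (ℕ; _+_; _*_; _≥_; _≤_; _⊔_; suc; zero; pred)
open import Data.Nat.Properties using (≤-refl; ≤-trans; ≤-reflexive; m⊔n≤o⇒m≤o; m⊔n≤o⇒n≤o)
open import Data.Fin using (Fin; zero; suc)
open import Data.Product using (Σ; ∃; _×_; _,_)
open import Data.List.Base using (allFin)

Eventually : (ℕ → Set) → Set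
Eventually Q = ∃ λ N → ∀ n → n ≥ N → Q n

module _ {Q R : ℕ → Set} where

  eventually-× : Eventually Q → Eventually R → Eventually (λ n → Q n × R n)
  eventually-× (N , q) (M , r) = N ⊔ M , λ n n≥ → q n (m⊔n≤o⇒m≤o N M n≥) , r n (m⊔n≤o⇒n≤o N M n≥)

  eventually-map : (∀ n → Q n → R n) → Eventually Q → Eventually R
  eventually-map f (N , q) = N , λ n n≥N → f n (q n n≥N)

eventually-≥ : ∀ m → Eventually (m ≤_)
eventually-≥ m = m , λ _ m≤n → m≤n

partSize-≤ : ∀ {n} (P : Partition n) i → partSize P i ≤ n
partSize-≤ {n} P i = ≤-trans (count≤length _ (allFin n)) (≤-reflexive length-allFin)

proposition4p6 :
    (G : (n : ℕ) → Graph n) →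
    (∀ n → IndepAtMost2 (G n)) →
    T4Asymp G →
    (P : (n : ℕ) → Partition n) →
    (h : ℕ → ℕ) → LittleO h →
    (∀ n → Cond1 (G n) (P n) (h n)) →
    (∀ n → UnionClique (G n) (P n) (suc zero) (suc (suc zero))) →
    (∀ n → UnionClique (G n) (P n) (suc (suc zero)) (suc (suc (suc zero)))) →
    (∀ n → UnionClique (G n) (P n) (suc (suc (suc zero))) (suc (suc (suc (suc zero))))) →
    ApproxLinear 1 5 (λ n → partSize (P n) zero) →
    ApproxLinear 2 5 (λ n → partSize (P n) (suc zero) + partSize (P n) (suc (suc zero))) →
    ApproxLinear 2 5 (λ n → partSize (P n) (suc (suc zero)) + partSize (P n) (suc (suc (suc zero)))) →
    ApproxLinear 2 5 (λ n → partSize (P n) (suc (suc (suc zero))) + partSize (P n) (suc (suc (suc (suc zero))))) →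
    LittleO (λ n → uSize (P n)) →
    (∃ λ N → ∀ n → n ≥ N → ∀ (i : Fin 5) → UnionClique (G n) (P n) i (i ⊕ 1))
    × (∀ (i : Fin 5) → ApproxLinear 1 5 (λ n → partSize (P n) i))
proposition4p6 G α≤2 t4≈ P h h≈0 cond1 _ _ _ class0 pair12 pair23 pair34 _ = cliques , sizes
  where
  Accurate : ℕ → ℕ → Set
  Accurate K n = Precise (precision K) n (t4 (G n)) (h n) (partSize (P n)) × 150000 * (suc K * suc K) ≤ n
  accurate : ∀ K → Eventually (Accurate K)
  accurate K = eventually-map (λ n ((((((t , c0) , p12) , p23) , p34) , hs) , large) →
      record { t-close = t ; class0 = c0 ; pair12 = p12 ; pair23 = p23 ; pair34 = p34 ; h-small = hs } , large)
    (eventually-× (eventually-× (eventually-× (eventually-× (eventually-× (eventually-× (t4≈ k) (class0 k)) (pair12 k))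
      (pair23 k)) (pair34 k)) (h≈0 k)) (eventually-≥ (150000 * (suc K * suc K))))
    where
    -- suc k reduces to precision K, so the hypotheses at k are exactly the fields of Precise.
    k : ℕ
    k = pred (precision K)
  sizes : ∀ i → ApproxLinear 1 5 (λ n → partSize (P n) i)
  sizes i K = eventually-map (λ n (precise , large) →
    class-deviation (partSize-≤ (P n)) (consecutive-pairs-bound (G n) (P n) (h n) (cond1 n)) precise large i) (accurate K)
  cliques : ∃ λ N → ∀ n → n ≥ N → ∀ i → UnionClique (G n) (P n) i (i ⊕ 1)
  cliques = eventually-map (λ n (precise , large) i → consecutive-union-clique (G n) (P n) (h n) i (α≤2 n) (cond1 n)
    (classes-exceed-2h (partSize-≤ (P n)) (consecutive-pairs-bound (G n) (P n) (h n) (cond1 n)) precise large ≤-refl (i ⊕ 3)))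
    (accurate 9)
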